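{- For every integer $k\ge 3$, every inflation $G$ of the complement $\overline{C_k}$ of the $k$-cycle with $\alpha(G)=2$ has a model of $K_{\chi(G)}$ in which every branch set has at most two vertices.
   Context: All graphs are finite and simple. An inflation of a graph $H$ is obtained by choosing integers $c_x\ge 0$ for $x\in V(H)$, replacing each $x$ by a clique $C_x$ of order $c_x$, with every vertex of $C_x$ adjacent to every vertex of $C_y$ ($x\neq y$) if $xy\in E(H)$ and no edges between them otherwise. A model of $K_t$ in $G$ is a collection of $t$ pairwise disjoint vertex sets (branch sets), each inducing a connected subgraph, with an edge of $G$ between every two of them. -}

module Defs where

open import Level using (0ℓ)
open import Data.Nat using (ℕ; zero; suc; _≤_; _<_)
open import Data.Fin using (Fin; toℕ)
open import Data.Product using (Σ; Σ-syntax; ∃; ∃-syntax; _×_; _,_; proj₁; proj₂)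
open import Data.Sum using (_⊎_)
open import Data.List using (List; []; _∷_; length)
open import Data.List.Membership.Propositional using (_∈_)
open import Data.List.Relation.Unary.All using (All)
open import Data.List.Relation.Unary.Unique.Propositional using (Unique)
open import Relation.Binary.PropositionalEquality using (_≡_; _≢_)
open import Relation.Nullary using (¬_)

-- Graphs: a vertex type with an adjacency relation.
-- (The graphs used in the statement are finite, simple: irreflexive and
-- symmetric adjacency on a finite vertex type.)

record Graph : Set₁ where
  field
    V   : Set
    Adj : V → V → Set
open Graph public

IsIndependent : (G : Graph) → List (V G) → Set
IsIndependent G S =
  Unique S × (∀ {u v} → u ∈ S → v ∈ S → ¬ Adj G u v)

IndependenceNumber : Graph → ℕ → Set
IndependenceNumber G a =
  (Σ[ S ∈ List (V G) ] (IsIndependent G S × length S ≡ a))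
  × (∀ S → IsIndependent G S → length S ≤ a)

ProperColouring : (G : Graph) (t : ℕ) → (V G → Fin t) → Set
ProperColouring G t f = ∀ {u v} → Adj G u v → f u ≢ f v

Colourable : Graph → ℕ → Set
Colourable G t = Σ[ f ∈ (V G → Fin t) ] ProperColouring G t f

ChromaticNumber : Graph → ℕ → Set
ChromaticNumber G t = Colourable G t × (∀ s → s < t → ¬ Colourable G s)

-- a walk from u to v using only vertices of S (u itself is assumed in S)
data WalkIn (G : Graph) (S : List (V G)) : V G → V G → Set where
  here : ∀ {u} → WalkIn G S u u
  step : ∀ {u w v} → Adj G u w → w ∈ S → WalkIn G S w v → WalkIn G S u v

InducesConnected : (G : Graph) → List (V G) → Set
InducesConnected G S =
  (Σ[ v ∈ V G ] v ∈ S) × (∀ {u v} → u ∈ S → v ∈ S → WalkIn G S u v)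

record KModel (G : Graph) (t : ℕ) : Set where
  field
    branch    : Fin t → List (V G)
    unique    : ∀ i → Unique (branch i)
    connected : ∀ i → InducesConnected G (branch i)
    disjoint  : ∀ {i j} → i ≢ j → ∀ {v} → v ∈ branch i → ¬ (v ∈ branch j)
    touching  : ∀ {i j} → i ≢ j →
                Σ[ u ∈ V G ] Σ[ v ∈ V G ] (u ∈ branch i × v ∈ branch j × Adj G u v)
open KModel public

CycleAdj : (k : ℕ) → Fin k → Fin k → Set
CycleAdj k x y =
  suc (toℕ x) ≡ toℕ y ⊎ suc (toℕ y) ≡ toℕ x
  ⊎ (toℕ x ≡ 0 × suc (toℕ y) ≡ k) ⊎ (toℕ y ≡ 0 × suc (toℕ x) ≡ k)

ComplementCycle : ℕ → Graph
ComplementCycle k = record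
  { V   = Fin k
  ; Adj = λ x y → x ≢ y × ¬ CycleAdj k x y }

-- Inflation of a graph H on vertex set Fin n: vertex x replaced by a
-- clique of order c x; two distinct vertices are adjacent iff they lie in
-- the same clique or in cliques C_x, C_y with xy ∈ E(H).

Inflation : (n : ℕ) → (Fin n → Fin n → Set) → (Fin n → ℕ) → Graph
Inflation n HAdj c = record
  { V   = Σ[ x ∈ Fin n ] Fin (c x)
  ; Adj = λ u v → u ≢ v × (proj₁ u ≡ proj₁ v ⊎ HAdj (proj₁ u) (proj₁ v)) }

InflatedComplementCycle : (k : ℕ) → (Fin k → ℕ) → Graph
InflatedComplementCycle k c = Inflation k (Adj (ComplementCycle k)) c

-- Colour classes of G have at most two vertices, taken from cycle-adjacent
-- classes, so everything is about the clique sizes w : Fin k → ℕ.  It suffices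
-- to cover w by colour classes and to find at least as many disjoint, pairwise
-- touching branch sets of at most two vertices (a certificate).
--
-- If some class is empty, G is an inflated complement of a path.  Colouring
-- greedily along the path uses as many colours as a heaviest stable set of the
-- path, and the classes of that set span a clique of G.  For k = 3, α(G) = 2
-- forces an empty class; for k = 4, G is the disjoint union of two cliques.
-- For k = 5, G is an inflated 5-cycle: if a heaviest clique outweighs the
-- other vertices, a colouring along a suitable path matches it; otherwise
-- explicit pair multiplicities give ⌈|G|/2⌉ colours, matched by branch sets
-- built from a heaviest class and the pairs {1,3}, {2,4}.  For k ≥ 6 with no
-- empty class, the colour classes {0,1}, {3,4} are traded for the branch sets
-- {0,3}, {1,4}, which touch every vertex, and induction on |C₀| applies.

{-# OPTIONS --safe #-}
module Submission where

open import Defs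
open import Data.Empty using (⊥)
open import Data.Fin.Base as Fin using (Fin; zero; suc; toℕ; fromℕ<; inject≤)
open import Data.Fin.Properties as Finₚ using (toℕ-injective; toℕ-fromℕ<; toℕ<n)
open import Data.List.Base using (List; []; _∷_; _++_; length; replicate; map; lookup; allFin)
open import Data.List.Properties using (length-++; length-replicate; length-map; map-∘; map-id)
open import Data.List.Membership.Propositional using (_∈_)
open import Data.List.Membership.Propositional.Properties using (∈-lookup; ∈-allFin)
open import Data.List.Extrema.Nat using (argmax; f[xs]≤f[argmax])
open import Data.List.Relation.Unary.All as All using (All; []; _∷_)
import Data.List.Relation.Unary.All.Properties as Allₚ
open import Data.List.Relation.Unary.AllPairs as AllPairs using (AllPairs; []; _∷_)
import Data.List.Relation.Unary.AllPairs.Properties as AllPairsₚ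
open import Data.List.Relation.Unary.Any using (here; there)
open import Data.List.Relation.Unary.Unique.Propositional using (Unique)
open import Data.List.Relation.Unary.Linked as Linked using (Linked; []; [-]; _∷_)
open import Data.List.Relation.Binary.Sublist.Propositional using (_⊆_; []; _∷_; _∷ʳ_)
open import Data.List.Relation.Binary.Sublist.Propositional.Properties using (All-resp-⊆)
open import Data.Nat.Base using (ℕ; zero; suc; _+_; _*_; _∸_; _≤_; _<_; _⊔_; _⊓_; z≤n; s≤s; s≤s⁻¹)
open import Data.Nat.Properties
open import Data.Nat.DivMod using (_mod_; m<n⇒m%n≡m)
open import Data.Nat.Tactic.RingSolver using (solve-∀)
open import Data.Product.Base using (Σ-syntax; ∃-syntax; _×_; _,_; proj₁; proj₂)
open import Data.Sum.Base as Sum using (_⊎_; inj₁; inj₂)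
open import Data.Unit.Base using (⊤; tt)
open import Function.Base using (_∘_)
open import Relation.Binary.Definitions using (Decidable)
open import Relation.Binary.PropositionalEquality
open import Relation.Nullary using (¬_; Dec; yes; no; contradiction)
open import Relation.Nullary.Decidable using (_⊎-dec_; _×-dec_; _→-dec_; ¬?; False; toWitness; toWitnessFalse)

module _ {k : ℕ} where

  cycleAdj-sym : {a b : Fin k} → CycleAdj k a b → CycleAdj k b a
  cycleAdj-sym (inj₁ e)                 = inj₂ (inj₁ e)
  cycleAdj-sym (inj₂ (inj₁ e))          = inj₁ e
  cycleAdj-sym (inj₂ (inj₂ (inj₁ e)))   = inj₂ (inj₂ (inj₂ e))
  cycleAdj-sym (inj₂ (inj₂ (inj₂ e)))   = inj₂ (inj₂ (inj₁ e))

  private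
    3≤k⇒no-wrap : ∀ {n} → 3 ≤ k → n ≡ 0 → suc n ≢ k
    3≤k⇒no-wrap (s≤s (s≤s (s≤s _))) refl ()

  cycleAdj-irrefl : 3 ≤ k → {a : Fin k} → ¬ CycleAdj k a a
  cycleAdj-irrefl _   (inj₁ e)                      = 1+n≢n e
  cycleAdj-irrefl _   (inj₂ (inj₁ e))               = 1+n≢n e
  cycleAdj-irrefl 3≤k (inj₂ (inj₂ (inj₁ (a≡0 , e)))) = 3≤k⇒no-wrap 3≤k a≡0 e
  cycleAdj-irrefl 3≤k (inj₂ (inj₂ (inj₂ (a≡0 , e)))) = 3≤k⇒no-wrap 3≤k a≡0 e

  cycleAdj? : Decidable (CycleAdj k)
  cycleAdj? a b = (suc (toℕ a) ≟ toℕ b) ⊎-dec (suc (toℕ b) ≟ toℕ a)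
                  ⊎-dec ((toℕ a ≟ 0) ×-dec (suc (toℕ b) ≟ k))
                  ⊎-dec ((toℕ b ≟ 0) ×-dec (suc (toℕ a) ≟ k))

  ¬cycleAdj : (a b : Fin k) {_ : False (cycleAdj? a b)} → ¬ CycleAdj k a b
  ¬cycleAdj a b {≁} = toWitnessFalse ≁

indicator : ∀ {k} → Fin k → Fin k → ℕ
indicator a x with a Finₚ.≟ x
... | yes _ = 1
... | no  _ = 0

module _ {k : ℕ} where

  indicator-refl : (a : Fin k) → indicator a a ≡ 1
  indicator-refl a with a Finₚ.≟ a
  ... | yes _  = refl
  ... | no a≢a = contradiction refl a≢a

  indicator-≢ : {a x : Fin k} → a ≢ x → indicator a x ≡ 0
  indicator-≢ {a} {x} a≢x with a Finₚ.≟ x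
  ... | yes a≡x = contradiction a≡x a≢x
  ... | no  _   = refl

  indicator≤1 : (a x : Fin k) → indicator a x ≤ 1
  indicator≤1 a x with a Finₚ.≟ x
  ... | yes _ = s≤s z≤n
  ... | no  _ = z≤n

  indicator-pos : {a x : Fin k} → 0 < indicator a x → a ≡ x
  indicator-pos {a} {x} p with a Finₚ.≟ x
  ... | yes a≡x = a≡x

-- [single a] stands for a vertex of the clique C_a, [pair a b] for a vertex of
-- C_a and another one of C_b.  Vertices of different classes are non-adjacent
-- iff their classes are cycle-adjacent, so a pair is a colour class iff its
-- classes are cycle-adjacent and a (connected) branch set iff they are not.
data Shape (k : ℕ) : Set where
  single : Fin k → Shape k
  pair   : Fin k → Fin k → Shape k

module _ {k : ℕ} where

  load : Shape k → Fin k → ℕ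
  load (single a) x = indicator a x
  load (pair a b) x = indicator a x + indicator b x

  loads : List (Shape k) → Fin k → ℕ
  loads []       x = 0
  loads (s ∷ ss) x = load s x + loads ss x

  loads-++ : ∀ ss ts x → loads (ss ++ ts) x ≡ loads ss x + loads ts x
  loads-++ []       ts x = refl
  loads-++ (s ∷ ss) ts x = trans (cong (load s x +_) (loads-++ ss ts x)) (sym (+-assoc (load s x) _ _))

  loads-replicate : ∀ n s x → loads (replicate n s) x ≡ n * load s x
  loads-replicate zero    s x = refl
  loads-replicate (suc n) s x = cong (load s x +_) (loads-replicate n s x)

  _∈ₛ_ : Fin k → Shape k → Set
  x ∈ₛ single a = x ≡ a
  x ∈ₛ pair a b = x ≡ a ⊎ x ≡ b

  IsColourClass : Shape k → Set
  IsColourClass (single _) = ⊤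
  IsColourClass (pair a b) = CycleAdj k a b

  IsBranchSet : Shape k → Set
  IsBranchSet (single _) = ⊤
  IsBranchSet (pair a b) = ¬ CycleAdj k a b

  Touches : Shape k → Shape k → Set
  Touches s t = ∃[ a ] ∃[ b ] a ∈ₛ s × b ∈ₛ t × ¬ CycleAdj k a b

  Dominates : Shape k → (Fin k → ℕ) → Set
  Dominates s u = ∀ a → 0 < u a → ∃[ b ] b ∈ₛ s × ¬ CycleAdj k a b

  ∃-loaded-class : ∀ s → ∃[ a ] a ∈ₛ s × 0 < load s a
  ∃-loaded-class (single a) = a , refl , ≤-reflexive (sym (indicator-refl a))
  ∃-loaded-class (pair a b) = a , inj₁ refl , ≤-trans (≤-reflexive (sym (indicator-refl a))) (m≤m+n _ _)

  touches-self : 3 ≤ k → ∀ s → Touches s s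
  touches-self 3≤k s = let a , a∈s , _ = ∃-loaded-class s in a , a , a∈s , a∈s , cycleAdj-irrefl 3≤k

  dominates⇒touches : ∀ {s u} ts → Dominates s u → (∀ x → loads ts x ≤ u x) → All (Touches s) ts
  dominates⇒touches         []       dom fits = []
  dominates⇒touches {s} {u} (t ∷ ts) dom fits =
    touch ∷ dominates⇒touches ts dom (λ x → ≤-trans (m≤n+m _ _) (fits x))
    where
    touch : Touches s t
    touch with ∃-loaded-class t
    ... | a , a∈t , 0<load with dom a (≤-trans 0<load (≤-trans (m≤m+n _ _) (fits a)))
    ...   | b , b∈s , a≁b = b , a , b∈s , a∈t , a≁b ∘ cycleAdj-sym

  -- A colouring of the inflation by w, and a model of a complete graph with
  -- branch sets of at most two vertices and at least as many branch sets as
  -- there are colours.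
  record Certificate (w : Fin k → ℕ) : Set where
    field
      colours branches : List (Shape k)
      colours-ok       : All IsColourClass colours
      branches-ok      : All IsBranchSet branches
      covers           : ∀ x → w x ≤ loads colours x
      fits             : ∀ x → loads branches x ≤ w x
      touching         : AllPairs Touches branches
      fewer-colours    : length colours ≤ length branches

  -- Branch sets dominating the remainder touch every branch set of a
  -- certificate for the remainder, so both parts combine (extend).
  record Reduction (w : Fin k → ℕ) : Set where
    field
      colours branches : List (Shape k)
      colours-ok       : All IsColourClass colours
      branches-ok      : All IsBranchSet branches
      colours-fit      : ∀ x → loads colours x ≤ w x
      branches-fit     : ∀ x → loads branches x ≤ loads colours x
      touching         : AllPairs Touches branches
      dominating       : All (λ s → Dominates s (λ x → w x ∸ loads colours x)) branches
      fewer-colours    : length colours ≤ length branches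

    remainder : Fin k → ℕ
    remainder x = w x ∸ loads colours x

  extend : ∀ {w} (R : Reduction w) → Certificate (Reduction.remainder R) → Certificate w
  extend {w} R C = record
    { colours       = R.colours ++ C.colours
    ; branches      = R.branches ++ C.branches
    ; colours-ok    = Allₚ.++⁺ R.colours-ok C.colours-ok
    ; branches-ok   = Allₚ.++⁺ R.branches-ok C.branches-ok
    ; covers        = λ x → begin
        w x                                 ≤⟨ m≤n+m∸n (w x) (loads R.colours x) ⟩
        loads R.colours x + R.remainder x   ≤⟨ +-monoʳ-≤ (loads R.colours x) (C.covers x) ⟩
        loads R.colours x + loads C.colours x ≡⟨ loads-++ R.colours C.colours x ⟨
        loads (R.colours ++ C.colours) x    ∎
    ; fits          = λ x → begin
        loads (R.branches ++ C.branches) x      ≡⟨ loads-++ R.branches C.branches x ⟩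
        loads R.branches x + loads C.branches x ≤⟨ +-mono-≤ (R.branches-fit x) (C.fits x) ⟩
        loads R.colours x + R.remainder x       ≡⟨ m+[n∸m]≡n (R.colours-fit x) ⟩
        w x                                     ∎
    ; touching      = AllPairsₚ.++⁺ R.touching C.touching
                        (All.map (λ dom → dominates⇒touches C.branches dom C.fits) R.dominating)
    ; fewer-colours = begin
        length (R.colours ++ C.colours)       ≡⟨ length-++ R.colours ⟩
        length R.colours + length C.colours   ≤⟨ +-mono-≤ R.fewer-colours C.fewer-colours ⟩
        length R.branches + length C.branches ≡⟨ length-++ R.branches ⟨
        length (R.branches ++ C.branches)     ∎
    }
    where
    module R = Reduction R
    module C = Certificate C
    open ≤-Reasoning

module Realisation {k : ℕ} (3≤k : 3 ≤ k) (c : Fin k → ℕ) where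

  G : Graph
  G = InflatedComplementCycle k c

  adjacent : (u v : V G) → u ≢ v → ¬ CycleAdj k (proj₁ u) (proj₁ v) → Adj G u v
  adjacent u v u≢v ¬adj with proj₁ u Finₚ.≟ proj₁ v
  ... | yes same = u≢v , inj₁ same
  ... | no  diff = u≢v , inj₂ (diff , ¬adj)

  load≤1 : ∀ s x → IsColourClass s → load s x ≤ 1
  load≤1 (single a) x _ = indicator≤1 a x
  load≤1 (pair a b) x adj with a Finₚ.≟ x | b Finₚ.≟ x
  ... | yes refl | yes refl = contradiction adj (cycleAdj-irrefl 3≤k)
  ... | yes _    | no _     = s≤s z≤n
  ... | no _     | yes _    = s≤s z≤n
  ... | no _     | no _     = z≤n

  equal-or-adjacent : ∀ s {x y} → IsColourClass s → 0 < load s x → 0 < load s y → x ≡ y ⊎ CycleAdj k x y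
  equal-or-adjacent (single a) _ p q = inj₁ (trans (sym (indicator-pos p)) (indicator-pos q))
  equal-or-adjacent (pair a b) {x} {y} adj p q with a Finₚ.≟ x | b Finₚ.≟ x | a Finₚ.≟ y | b Finₚ.≟ y
  ... | yes refl | _        | yes refl | _        = inj₁ refl
  ... | yes refl | _        | no _     | yes refl = inj₂ adj
  ... | no _     | yes refl | yes refl | _        = inj₂ (cycleAdj-sym adj)
  ... | no _     | yes refl | no _     | yes refl = inj₁ refl

  m<n+o∧m≮n⇒m∸n<o : ∀ {i a b} → i < a + b → ¬ i < a → i ∸ a < b
  m<n+o∧m≮n⇒m∸n<o {i} {a} i<a+b i≮a = +-cancelˡ-< a (i ∸ a) _ (subst (_< a + _) (sym (m+[n∸m]≡n (≮⇒≥ i≮a))) i<a+b)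

  -- The i-th vertex of C_x gets the index of the colour class holding the i-th copy of x.
  slot : (L : List (Shape k)) (x : Fin k) (i : ℕ) → i < loads L x → Fin (length L)
  slot (s ∷ L) x i i< with i <? load s x
  ... | yes _ = zero
  ... | no i≮ = suc (slot L x (i ∸ load s x) (m<n+o∧m≮n⇒m∸n<o i< i≮))

  slot-clash : ∀ L → All IsColourClass L → ∀ {x y i j} (p : i < loads L x) (q : j < loads L y) →
               slot L x i p ≡ slot L y j q → (x ≡ y × i ≡ j) ⊎ CycleAdj k x y
  slot-clash (s ∷ L) (ok ∷ oks) {x} {y} {i} {j} p q same with i <? load s x | j <? load s y
  ... | yes i< | yes j< with equal-or-adjacent s ok (≤-trans (s≤s z≤n) i<) (≤-trans (s≤s z≤n) j<)
  ...   | inj₂ adj  = inj₂ adj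
  ...   | inj₁ refl = inj₁ (refl , trans (n<1⇒n≡0 (≤-trans i< (load≤1 s x ok)))
                                          (sym (n<1⇒n≡0 (≤-trans j< (load≤1 s x ok)))))
  slot-clash (s ∷ L) (ok ∷ oks) p q () | yes _ | no _
  slot-clash (s ∷ L) (ok ∷ oks) p q () | no _  | yes _
  slot-clash (s ∷ L) (ok ∷ oks) {x} {y} {i} {j} p q same | no i≮ | no j≮
    with slot-clash L oks (m<n+o∧m≮n⇒m∸n<o p i≮) (m<n+o∧m≮n⇒m∸n<o q j≮) (Finₚ.suc-injective same)
  ... | inj₂ adj          = inj₂ adj
  ... | inj₁ (refl , eq)  = inj₁ (refl , (begin
          i                       ≡⟨ m+[n∸m]≡n (≮⇒≥ i≮) ⟨
          load s x + (i ∸ load s x) ≡⟨ cong (load s x +_) eq ⟩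
          load s x + (j ∸ load s x) ≡⟨ m+[n∸m]≡n (≮⇒≥ j≮) ⟩
          j                       ∎))
    where open ≡-Reasoning

  colouring : (L : List (Shape k)) → (∀ x → c x ≤ loads L x) → V G → Fin (length L)
  colouring L covers (x , i) = slot L x (toℕ i) (≤-trans (toℕ<n i) (covers x))

  colouring-proper : ∀ L → All IsColourClass L → (covers : ∀ x → c x ≤ loads L x) →
                     ProperColouring G (length L) (colouring L covers)
  colouring-proper L oks covers {x , i} {y , j} (u≢v , adj) same with slot-clash L oks _ _ same
  ... | inj₁ (refl , i≡j) = u≢v (cong (x ,_) (toℕ-injective i≡j))
  ... | inj₂ cyc with adj
  ...   | inj₁ refl        = cycleAdj-irrefl 3≤k cyc
  ...   | inj₂ (_ , ¬cyc) = ¬cyc cyc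

  -- A shape is realised by the first unused vertices of its classes, the
  -- vertices (x , i) with i < off x being already used.
  Room : Shape k → (Fin k → ℕ) → Set
  Room s off = ∀ x → off x + load s x ≤ c x

  vertex : (x : Fin k) (i : ℕ) → i < c x → V G
  vertex x i i< = x , fromℕ< i<

  room⇒< : ∀ {n a m} → n + suc m ≤ a → n < a
  room⇒< {n} {a} {m} le = ≤-trans (s≤s (m≤m+n n m)) (subst (_≤ a) (+-suc n m) le)

  only< : ∀ a off → Room (single a) off → off a < c a
  only< a off r = room⇒< {m = 0} (subst (λ z → off a + z ≤ c a) (indicator-refl a) (r a))

  first< : ∀ a b off → Room (pair a b) off → off a < c a
  first< a b off r = room⇒< (subst (λ z → off a + (z + indicator b a) ≤ c a) (indicator-refl a) (r a))

  second< : ∀ a b off → Room (pair a b) off → off b + indicator a b < c b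
  second< a b off r = room⇒< {m = 0} (subst (_≤ c b) (sym (+-assoc (off b) (indicator a b) 1))
                        (subst (λ z → off b + (indicator a b + z) ≤ c b) (indicator-refl b) (r b)))

  realise : (s : Shape k) (off : Fin k → ℕ) → Room s off → List (V G)
  realise (single a) off r = vertex a (off a) (only< a off r) ∷ []
  realise (pair a b) off r = vertex a (off a) (first< a b off r) ∷ vertex b (off b + indicator a b) (second< a b off r) ∷ []

  realise-≥ : ∀ s off r {v} → v ∈ realise s off r → off (proj₁ v) ≤ toℕ (proj₂ v)
  realise-≥ (single a) off r (here refl)         = ≤-reflexive (sym (toℕ-fromℕ< _))
  realise-≥ (pair a b) off r (here refl)         = ≤-reflexive (sym (toℕ-fromℕ< _))
  realise-≥ (pair a b) off r (there (here refl)) = ≤-trans (m≤m+n (off b) _) (≤-reflexive (sym (toℕ-fromℕ< _)))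

  realise-< : ∀ s off r {v} → v ∈ realise s off r → toℕ (proj₂ v) < off (proj₁ v) + load s (proj₁ v)
  realise-< (single a) off r (here refl) rewrite toℕ-fromℕ< (only< a off r) | indicator-refl a =
    m<m+n (off a) (s≤s z≤n)
  realise-< (pair a b) off r (here refl) rewrite toℕ-fromℕ< (first< a b off r) | indicator-refl a =
    m<m+n (off a) (s≤s z≤n)
  realise-< (pair a b) off r (there (here refl)) rewrite toℕ-fromℕ< (second< a b off r) | indicator-refl b =
    subst (off b + indicator a b <_) (+-assoc (off b) (indicator a b) 1) (m<m+n _ (s≤s z≤n))

  realise-∋ : ∀ s off r {x} → x ∈ₛ s → ∃[ v ] v ∈ realise s off r × proj₁ v ≡ x
  realise-∋ (single a) off r refl        = _ , here refl , refl
  realise-∋ (pair a b) off r (inj₁ refl) = _ , here refl , refl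
  realise-∋ (pair a b) off r (inj₂ refl) = _ , there (here refl) , refl

  realise-unique : ∀ s off r → Unique (realise s off r)
  realise-unique (single a) off r = [] ∷ []
  realise-unique (pair a b) off r = (distinct ∷ []) ∷ [] ∷ []
    where
    distinct : vertex a (off a) (first< a b off r) ≢ vertex b (off b + indicator a b) (second< a b off r)
    distinct same with refl ← cong proj₁ same =
      1+n≢n (sym (trans (sym (toℕ-fromℕ< (first< a b off r)))
                 (trans (cong (λ v → toℕ (proj₂ v)) same)
                 (trans (toℕ-fromℕ< (second< a b off r))
                 (trans (cong (off a +_) (indicator-refl a)) (+-comm (off a) 1))))))

  realise-size : ∀ s off r → length (realise s off r) ≤ 2
  realise-size (single a) off r = s≤s z≤n
  realise-size (pair a b) off r = ≤-refl

  realise-connected : ∀ s off r → IsBranchSet s → InducesConnected G (realise s off r)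
  realise-connected (single a) off r _ = (_ , here refl) , λ { (here refl) (here refl) → WalkIn.here }
  realise-connected (pair a b) off r ¬adj = (_ , here refl) , walk
    where
    S = realise (pair a b) off r
    u≢v = All.head (AllPairs.head (realise-unique (pair a b) off r))
    u~v = adjacent _ _ u≢v ¬adj
    v~u = adjacent _ _ (u≢v ∘ sym) (¬adj ∘ cycleAdj-sym)
    walk : ∀ {u v} → u ∈ S → v ∈ S → WalkIn G S u v
    walk (here refl)         (here refl)         = WalkIn.here
    walk (here refl)         (there (here refl)) = step u~v (there (here refl)) WalkIn.here
    walk (there (here refl)) (here refl)         = step v~u (here refl) WalkIn.here
    walk (there (here refl)) (there (here refl)) = WalkIn.here

  record Realised (B : List (Shape k)) (off : Fin k → ℕ) : Set where
    field
      branch    : Fin (length B) → List (V G)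
      unique    : ∀ i → Unique (branch i)
      connected : ∀ i → InducesConnected G (branch i)
      disjoint  : ∀ {i j} → i ≢ j → ∀ {v} → v ∈ branch i → ¬ (v ∈ branch j)
      touching  : ∀ {i j} → i ≢ j → ∃[ u ] ∃[ v ] u ∈ branch i × v ∈ branch j × Adj G u v
      small     : ∀ i → length (branch i) ≤ 2
      above     : ∀ i {v} → v ∈ branch i → off (proj₁ v) ≤ toℕ (proj₂ v)
      meets     : ∀ i {x} → x ∈ₛ lookup B i → ∃[ v ] v ∈ branch i × proj₁ v ≡ x

  realise-all : (B : List (Shape k)) (off : Fin k → ℕ) → (∀ x → off x + loads B x ≤ c x) →
                All IsBranchSet B → AllPairs Touches B → Realised B off
  realise-all [] off room _ _ = record
    { branch = λ () ; unique = λ () ; connected = λ () ; disjoint = λ { {()} } ; touching = λ { {()} }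
    ; small = λ () ; above = λ () ; meets = λ () }
  realise-all (s ∷ B) off room (ok ∷ oks) (touches ∷ touchings) = record
    { branch = branch′ ; unique = unique′ ; connected = connected′ ; disjoint = disjoint′
    ; touching = touching′ ; small = small ; above = above ; meets = meets }
    where
    room-s : Room s off
    room-s x = ≤-trans (+-monoʳ-≤ (off x) (m≤m+n (load s x) (loads B x))) (room x)
    off′ : Fin k → ℕ
    off′ x = off x + load s x
    module R = Realised (realise-all B off′ (λ x → subst (_≤ c x) (sym (+-assoc (off x) _ _)) (room x)) oks touchings)
    H = realise s off room-s
    branch′ : Fin (length (s ∷ B)) → List (V G)
    branch′ zero    = H
    branch′ (suc i) = R.branch i
    apart : ∀ {i v} → v ∈ H → v ∈ R.branch i → ⊥
    apart {i} v∈H v∈R = <-irrefl refl (≤-trans (realise-< s off room-s v∈H) (R.above i v∈R))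
    unique′ : ∀ i → Unique (branch′ i)
    unique′ zero    = realise-unique s off room-s
    unique′ (suc i) = R.unique i
    connected′ : ∀ i → InducesConnected G (branch′ i)
    connected′ zero    = realise-connected s off room-s ok
    connected′ (suc i) = R.connected i
    small : ∀ i → length (branch′ i) ≤ 2
    small zero    = realise-size s off room-s
    small (suc i) = R.small i
    disjoint′ : ∀ {i j} → i ≢ j → ∀ {v} → v ∈ branch′ i → ¬ (v ∈ branch′ j)
    disjoint′ {zero}  {zero}  i≢j = contradiction refl i≢j
    disjoint′ {zero}  {suc j} _   = apart
    disjoint′ {suc i} {zero}  _   = λ v∈R v∈H → apart v∈H v∈R
    disjoint′ {suc i} {suc j} i≢j = R.disjoint (i≢j ∘ cong suc)
    touch-head : ∀ j → ∃[ u ] ∃[ v ] u ∈ H × v ∈ R.branch j × Adj G u v × Adj G v u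
    touch-head j with All.lookup touches (∈-lookup j)
    ... | a , b , a∈s , b∈t , ¬adj with realise-∋ s off room-s a∈s | R.meets j b∈t
    ...   | u , u∈H , refl | v , v∈R , refl =
      u , v , u∈H , v∈R , adjacent u v (λ u≡v → apart u∈H (subst (_∈ R.branch j) (sym u≡v) v∈R)) ¬adj
                        , adjacent v u (λ v≡u → apart u∈H (subst (_∈ R.branch j) v≡u v∈R)) (¬adj ∘ cycleAdj-sym)
    touching′ : ∀ {i j} → i ≢ j → ∃[ u ] ∃[ v ] u ∈ branch′ i × v ∈ branch′ j × Adj G u v
    touching′ {zero}  {zero}  i≢j = contradiction refl i≢j
    touching′ {zero}  {suc j} _   with touch-head j
    ... | u , v , u∈ , v∈ , u~v , _ = u , v , u∈ , v∈ , u~v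
    touching′ {suc i} {zero}  _   with touch-head i
    ... | u , v , u∈ , v∈ , _ , v~u = v , u , v∈ , u∈ , v~u
    touching′ {suc i} {suc j} i≢j = R.touching (i≢j ∘ cong suc)
    above : ∀ i {v} → v ∈ branch′ i → off (proj₁ v) ≤ toℕ (proj₂ v)
    above zero    v∈H = realise-≥ s off room-s v∈H
    above (suc i) v∈R = ≤-trans (m≤m+n _ _) (R.above i v∈R)
    meets : ∀ i {x} → x ∈ₛ lookup (s ∷ B) i → ∃[ v ] v ∈ branch′ i × proj₁ v ≡ x
    meets zero    = realise-∋ s off room-s
    meets (suc i) = R.meets i

  certificate⇒model : Certificate c → (t : ℕ) → ChromaticNumber G t →
                      Σ[ M ∈ KModel G t ] (∀ i → length (branch M i) ≤ 2)
  certificate⇒model C t (_ , minimal) = M , λ i → R.small (embed i)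
    where
    open Certificate C using (colours; branches; colours-ok; branches-ok; covers; fits; fewer-colours)
    recolour : V G → Fin (length branches)
    recolour v = inject≤ (colouring colours covers v) fewer-colours
    t≤|branches| : t ≤ length branches
    t≤|branches| = ≮⇒≥ λ |branches|<t → minimal _ |branches|<t
      (recolour , λ u~v same → colouring-proper colours colours-ok covers u~v
                                 (Finₚ.inject≤-injective _ _ _ _ same))
    embed : Fin t → Fin (length branches)
    embed i = inject≤ i t≤|branches|
    embed-injective : ∀ {i j} → embed i ≡ embed j → i ≡ j
    embed-injective = Finₚ.inject≤-injective _ _ _ _
    module R = Realised (realise-all branches (λ _ → 0) fits branches-ok (Certificate.touching C))
    M : KModel G t
    M = record
      { branch    = R.branch ∘ embed
      ; unique    = R.unique ∘ embed
      ; connected = R.connected ∘ embed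
      ; disjoint  = λ i≢j → R.disjoint (i≢j ∘ embed-injective)
      ; touching  = λ i≢j → R.touching (i≢j ∘ embed-injective)
      }

module _ {k : ℕ} where

  blocks : List (ℕ × Shape k) → List (Shape k)
  blocks []             = []
  blocks ((n , s) ∷ bs) = replicate n s ++ blocks bs

  blocks-load : List (ℕ × Shape k) → Fin k → ℕ
  blocks-load []             x = 0
  blocks-load ((n , s) ∷ bs) x = n * load s x + blocks-load bs x

  blocks-size : List (ℕ × Shape k) → ℕ
  blocks-size []             = 0
  blocks-size ((n , _) ∷ bs) = n + blocks-size bs

  loads-blocks : ∀ bs x → loads (blocks bs) x ≡ blocks-load bs x
  loads-blocks []             x = refl
  loads-blocks ((n , s) ∷ bs) x =
    trans (loads-++ (replicate n s) (blocks bs) x) (cong₂ _+_ (loads-replicate n s x) (loads-blocks bs x))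

  length-blocks : ∀ bs → length (blocks bs) ≡ blocks-size bs
  length-blocks []             = refl
  length-blocks ((n , s) ∷ bs) =
    trans (length-++ (replicate n s)) (cong₂ _+_ (length-replicate n) (length-blocks bs))

  blocks⁺ : ∀ {P : Shape k → Set} {bs} → All (P ∘ proj₂) bs → All P (blocks bs)
  blocks⁺ {bs = []}           []       = []
  blocks⁺ {bs = (n , s) ∷ bs} (p ∷ ps) = Allₚ.++⁺ (Allₚ.replicate⁺ n p) (blocks⁺ ps)

  blocks-touch : ∀ {bs} → All (λ b → Touches (proj₂ b) (proj₂ b)) bs →
                 AllPairs (λ b b′ → Touches (proj₂ b) (proj₂ b′)) bs → AllPairs Touches (blocks bs)
  blocks-touch {[]}           []             []               = []
  blocks-touch {(n , s) ∷ bs} (self ∷ selves) (across ∷ acrosses) =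
    AllPairsₚ.++⁺ (replicate-touch n) (blocks-touch selves acrosses)
                  (Allₚ.replicate⁺ n (blocks⁺ across))
    where
    replicate-touch : ∀ n → AllPairs Touches (replicate n s)
    replicate-touch zero    = []
    replicate-touch (suc n) = Allₚ.replicate⁺ n self ∷ replicate-touch n

  -- A weighted list [(v₁ , a₁) , …] stands for a₁ vertices of class v₁, ….
  weightOf : List (Fin k × ℕ) → Fin k → ℕ
  weightOf []             x = 0
  weightOf ((v , a) ∷ ps) x = a * indicator v x + weightOf ps x

  mass : List (Fin k × ℕ) → ℕ
  mass []             = 0
  mass ((_ , a) ∷ ps) = a + mass ps

  weighted : (Fin k → ℕ) → List (Fin k) → List (Fin k × ℕ)
  weighted w = map (λ v → v , w v)

  weightOf-∉ : ∀ {x} ps → All (λ p → x ≢ proj₁ p) ps → weightOf ps x ≡ 0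
  weightOf-∉ []             []          = refl
  weightOf-∉ ((v , a) ∷ ps) (x≢v ∷ x∉ps) =
    cong₂ _+_ (trans (cong (a *_) (indicator-≢ (x≢v ∘ sym))) (*-zeroʳ a)) (weightOf-∉ ps x∉ps)

  weightOf-≤ : ∀ {w : Fin k → ℕ} ps → AllPairs (λ p q → proj₁ p ≢ proj₁ q) ps →
               All (λ p → proj₂ p ≤ w (proj₁ p)) ps → ∀ x → weightOf ps x ≤ w x
  weightOf-≤ []             _                 _             x = z≤n
  weightOf-≤ ((v , a) ∷ ps) (v∉ps ∷ distinct) (a≤ ∷ bounds) x with v Finₚ.≟ x
  ... | no _ rewrite *-zeroʳ a = weightOf-≤ ps distinct bounds x
  ... | yes refl rewrite *-identityʳ a | weightOf-∉ ps v∉ps | +-identityʳ a = a≤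

  weightOf-∈ : ∀ (w : Fin k → ℕ) {x vs} → x ∈ vs → w x ≤ weightOf (weighted w vs) x
  weightOf-∈ w {x} (here refl) rewrite indicator-refl x | *-identityʳ (w x) = m≤m+n _ _
  weightOf-∈ w (there x∈vs) = ≤-trans (weightOf-∈ w x∈vs) (m≤n+m _ _)

  weightOf-≥ : ∀ {u : Fin k → ℕ} ps → All (λ p → u (proj₁ p) ≤ proj₂ p) ps → ∀ {x} → x ∈ map proj₁ ps → u x ≤ weightOf ps x
  weightOf-≥ ((v , a) ∷ ps) (u≤a ∷ _) (here refl) rewrite indicator-refl v | *-identityʳ a = ≤-trans u≤a (m≤m+n a _)
  weightOf-≥ ((v , a) ∷ ps) (_ ∷ bounds) (there x∈ps) = ≤-trans (weightOf-≥ ps bounds x∈ps) (m≤n+m _ _)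

  singleBlock : Fin k × ℕ → ℕ × Shape k
  singleBlock (v , a) = a , single v

  singletons : List (Fin k × ℕ) → List (Shape k)
  singletons ps = blocks (map singleBlock ps)

  loads-singletons : ∀ ps x → loads (singletons ps) x ≡ weightOf ps x
  loads-singletons ps x = trans (loads-blocks (map singleBlock ps) x) (blocks-load-singles ps)
    where
    blocks-load-singles : ∀ ps → blocks-load (map singleBlock ps) x ≡ weightOf ps x
    blocks-load-singles []       = refl
    blocks-load-singles (p ∷ ps) = cong (_ +_) (blocks-load-singles ps)

  length-singletons : ∀ ps → length (singletons ps) ≡ mass ps
  length-singletons ps = trans (length-blocks (map singleBlock ps)) (blocks-size-singles ps)
    where
    blocks-size-singles : ∀ ps → blocks-size (map singleBlock ps) ≡ mass ps
    blocks-size-singles []       = refl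
    blocks-size-singles (p ∷ ps) = cong (_ +_) (blocks-size-singles ps)

  singletons-ok : ∀ ps → All IsBranchSet (singletons ps)
  singletons-ok ps = blocks⁺ (Allₚ.map⁺ (All.universal (λ _ → tt) ps))

  NonAdjacent : Fin k × ℕ → Fin k × ℕ → Set
  NonAdjacent p q = ¬ CycleAdj k (proj₁ p) (proj₁ q)

  singletons-touch : 3 ≤ k → ∀ {ps} → AllPairs NonAdjacent ps → AllPairs Touches (singletons ps)
  singletons-touch 3≤k {ps} apart =
    blocks-touch (Allₚ.map⁺ (All.universal (λ p → touches-self 3≤k (single (proj₁ p))) ps))
                 (AllPairsₚ.map⁺ (AllPairs.map (λ {p} {q} ¬adj → proj₁ p , proj₁ q , refl , refl , ¬adj) apart))

  weightOf-⊆ : ∀ {qs ps} → qs ⊆ ps → ∀ x → weightOf qs x ≤ weightOf ps x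
  weightOf-⊆ []          x = z≤n
  weightOf-⊆ (p ∷ʳ qs⊆ps) x = ≤-trans (weightOf-⊆ qs⊆ps x) (m≤n+m _ _)
  weightOf-⊆ (refl ∷ qs⊆ps) x = +-monoʳ-≤ _ (weightOf-⊆ qs⊆ps x)

  Colouring : (Fin k → ℕ) → ℕ → Set
  Colouring w n = ∃[ L ] All IsColourClass L × (∀ x → w x ≤ loads L x) × length L ≤ n

  Clique : (Fin k → ℕ) → ℕ → Set
  Clique w n = ∃[ qs ] AllPairs NonAdjacent qs × (∀ x → weightOf qs x ≤ w x) × n ≤ mass qs

  Clique-mono : ∀ {w : Fin k → ℕ} {n m} → m ≤ n → Clique w n → Clique w m
  Clique-mono m≤n (qs , apart , fits , large) = qs , apart , fits , ≤-trans m≤n large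

  clique-pair : ∀ (w : Fin k → ℕ) {a b} → a ≢ b → ¬ CycleAdj k a b → Clique w (w a + w b)
  clique-pair w a≢b a≁b =
    weighted w (_ ∷ _ ∷ []) , (a≁b ∷ []) ∷ [] ∷ [] , weightOf-≤ _ ((a≢b ∷ []) ∷ [] ∷ []) (≤-refl ∷ ≤-refl ∷ []) ,
    ≤-reflexive (cong (w _ +_) (sym (+-identityʳ _)))

  colouring+clique⇒certificate : 3 ≤ k → ∀ {w n} → Colouring w n → Clique w n → Certificate w
  colouring+clique⇒certificate 3≤k (L , ok , covers , size) (qs , apart , fits , large) = record
    { colours       = L
    ; branches      = singletons qs
    ; colours-ok    = ok
    ; branches-ok   = singletons-ok qs
    ; covers        = covers
    ; fits          = λ x → subst (_≤ _) (sym (loads-singletons qs x)) (fits x)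
    ; touching      = singletons-touch 3≤k apart
    ; fewer-colours = ≤-trans size (≤-trans large (≤-reflexive (sym (length-singletons qs))))
    }

data Chordless {k : ℕ} : List (Fin k) → Set where
  []  : Chordless []
  [-] : ∀ {v} → Chordless (v ∷ [])
  _∷_ : ∀ {v u vs} → All (λ x → ¬ CycleAdj k v x) vs → Chordless (u ∷ vs) → Chordless (v ∷ u ∷ vs)

Chordless-tail : ∀ {k} {u : Fin k} {vs} → Chordless (u ∷ vs) → Chordless vs
Chordless-tail [-]      = []
Chordless-tail (_ ∷ cs) = cs

module _ {k : ℕ} where

  -- The weight of a heaviest set of pairwise non-consecutive entries.
  stable : List (Fin k × ℕ) → ℕ
  stable []                 = 0
  stable ((_ , a) ∷ [])     = a
  stable ((_ , a) ∷ p ∷ ps) = (a + stable ps) ⊔ stable (p ∷ ps)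

  stable-clique : ∀ ps → Chordless (map proj₁ ps) →
                  ∃[ qs ] qs ⊆ ps × AllPairs NonAdjacent qs × mass qs ≡ stable ps
  stable-clique []             _ = [] , [] , [] , refl
  stable-clique (p ∷ [])       _ = p ∷ [] , refl ∷ [] , [] ∷ [] , +-identityʳ _
  stable-clique (p ∷ q ∷ ps) (far ∷ chordless) =
    pick (stable (q ∷ ps) ≤? proj₂ p + stable ps)
         (stable-clique ps (Chordless-tail chordless)) (stable-clique (q ∷ ps) chordless)
    where
    Selection : List (Fin k × ℕ) → Set
    Selection ps = ∃[ qs ] qs ⊆ ps × AllPairs NonAdjacent qs × mass qs ≡ stable ps
    pick : Dec (stable (q ∷ ps) ≤ proj₂ p + stable ps) → Selection ps → Selection (q ∷ ps) → Selection (p ∷ q ∷ ps)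
    pick (yes ≤a+) (qs , qs⊆ps , apart , mass≡) _ =
      p ∷ qs , refl ∷ (q ∷ʳ qs⊆ps) , All-resp-⊆ qs⊆ps (Allₚ.map⁻ far) ∷ apart ,
      trans (cong (proj₂ p +_) mass≡) (sym (m≥n⇒m⊔n≡m ≤a+))
    pick (no ≰a+) _ (qs , qs⊆ps , apart , mass≡) =
      qs , p ∷ʳ qs⊆ps , apart , trans mass≡ (sym (m≤n⇒m⊔n≡n (<⇒≤ (≰⇒> ≰a+))))

  stable-shift : ∀ {a b} v u ps → a ≤ b → a + stable ((u , b ∸ a) ∷ ps) ≤ stable ((v , a) ∷ (u , b) ∷ ps)
  stable-shift {a} {b} v u [] a≤b = ≤-trans (≤-reflexive (m+[n∸m]≡n a≤b)) (m≤n⊔m _ b)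
  stable-shift {a} {b} v u (q ∷ ps) a≤b = begin
    a + ((b ∸ a + stable ps) ⊔ stable (q ∷ ps))         ≡⟨ +-distribˡ-⊔ a _ _ ⟩
    (a + (b ∸ a + stable ps)) ⊔ (a + stable (q ∷ ps))   ≡⟨ cong (_⊔ (a + stable (q ∷ ps))) (trans (sym (+-assoc a _ _)) (cong (_+ stable ps) (m+[n∸m]≡n a≤b))) ⟩
    (b + stable ps) ⊔ (a + stable (q ∷ ps))             ≤⟨ ⊔-lub (≤-trans (m≤m⊔n (b + stable ps) (stable (q ∷ ps))) (m≤n⊔m (a + stable (q ∷ ps)) _))
                                                                  (m≤m⊔n (a + stable (q ∷ ps)) _) ⟩
    (a + stable (q ∷ ps)) ⊔ ((b + stable ps) ⊔ stable (q ∷ ps)) ∎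
    where open ≤-Reasoning

  Colouring-mono : ∀ {w : Fin k → ℕ} {n m} → n ≤ m → Colouring w n → Colouring w m
  Colouring-mono n≤m (L , ok , covers , size) = L , ok , covers , ≤-trans size n≤m

  prepend : ∀ {w w′ : Fin k → ℕ} {n} L₀ → All IsColourClass L₀ → (∀ x → w x ≤ loads L₀ x + w′ x) →
            Colouring w′ n → Colouring w (length L₀ + n)
  prepend L₀ ok₀ covers₀ (L , ok , covers , size) =
    L₀ ++ L , Allₚ.++⁺ ok₀ ok ,
    (λ x → ≤-trans (covers₀ x) (≤-trans (+-monoʳ-≤ (loads L₀ x) (covers x)) (≤-reflexive (sym (loads-++ L₀ L x))))) ,
    ≤-trans (≤-reflexive (length-++ L₀)) (+-monoʳ-≤ (length L₀) size)

  -- A greedy step along a path v, u, … with weights a, b: pair vertices of C_v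
  -- and C_u as often as possible; the surplus of v is coloured alone
  -- (absorb-next), or the surplus of u is left to the rest of the path (pass-on).
  absorb-next : ∀ {v u a b ps n} → CycleAdj k v u → b ≤ a → Colouring (weightOf ps) n →
                Colouring (weightOf ((v , a) ∷ (u , b) ∷ ps)) (a + n)
  absorb-next {v} {u} {a} {b} {ps} {n} v~u b≤a =
    subst (λ m → Colouring (weightOf ((v , a) ∷ (u , b) ∷ ps)) (m + n)) (trans (length-++ (replicate b (pair v u)))
                                      (trans (cong₂ _+_ (length-replicate b) (length-replicate (a ∸ b))) (m+[n∸m]≡n b≤a)))
      ∘ prepend (replicate b (pair v u) ++ replicate (a ∸ b) (single v))
                (Allₚ.++⁺ (Allₚ.replicate⁺ b v~u) (Allₚ.replicate⁺ (a ∸ b) tt))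
                (λ x → ≤-reflexive (begin
        a * indicator v x + (b * indicator u x + weightOf ps x)
          ≡⟨ cong (λ a → a * indicator v x + (b * indicator u x + weightOf ps x)) (m+[n∸m]≡n b≤a) ⟨
        (b + (a ∸ b)) * indicator v x + (b * indicator u x + weightOf ps x)
          ≡⟨ split (indicator v x) (indicator u x) (weightOf ps x) ⟩
        (b * load (pair v u) x + (a ∸ b) * load (single v) x) + weightOf ps x
          ≡⟨ cong (_+ weightOf ps x) (cong₂ _+_ (loads-replicate b (pair v u) x) (loads-replicate (a ∸ b) (single v) x)) ⟨
        (loads (replicate b (pair v u)) x + loads (replicate (a ∸ b) (single v)) x) + weightOf ps x
          ≡⟨ cong (_+ weightOf ps x) (loads-++ (replicate b (pair v u)) (replicate (a ∸ b) (single v)) x) ⟨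
        loads (replicate b (pair v u) ++ replicate (a ∸ b) (single v)) x + weightOf ps x ∎))
    where
    open ≡-Reasoning
    split : ∀ iv iu W → (b + (a ∸ b)) * iv + (b * iu + W) ≡ (b * (iv + iu) + (a ∸ b) * iv) + W
    split iv iu W = distribute b (a ∸ b) iv iu W
      where distribute : ∀ b d iv iu W → (b + d) * iv + (b * iu + W) ≡ (b * (iv + iu) + d * iv) + W
            distribute = solve-∀

  pass-on : ∀ {v u a b ps n} → CycleAdj k v u → a ≤ b → Colouring (weightOf ((u , b ∸ a) ∷ ps)) n →
            Colouring (weightOf ((v , a) ∷ (u , b) ∷ ps)) (a + n)
  pass-on {v} {u} {a} {b} {ps} {n} v~u a≤b =
    subst (λ m → Colouring (weightOf ((v , a) ∷ (u , b) ∷ ps)) (m + n)) (length-replicate a)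
      ∘ prepend (replicate a (pair v u)) (Allₚ.replicate⁺ a v~u)
                (λ x → ≤-reflexive (begin
        a * indicator v x + (b * indicator u x + weightOf ps x)
          ≡⟨ cong (λ b → a * indicator v x + (b * indicator u x + weightOf ps x)) (m+[n∸m]≡n a≤b) ⟨
        a * indicator v x + ((a + (b ∸ a)) * indicator u x + weightOf ps x)
          ≡⟨ shift a (b ∸ a) (indicator v x) (indicator u x) (weightOf ps x) ⟩
        a * load (pair v u) x + weightOf ((u , b ∸ a) ∷ ps) x
          ≡⟨ cong (_+ weightOf ((u , b ∸ a) ∷ ps) x) (loads-replicate a (pair v u) x) ⟨
        loads (replicate a (pair v u)) x + weightOf ((u , b ∸ a) ∷ ps) x ∎))
    where
    open ≡-Reasoning
    shift : ∀ a d iv iu W → a * iv + ((a + d) * iu + W) ≡ a * (iv + iu) + (d * iu + W)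
    shift = solve-∀

  path-colouring : ∀ ps → Linked (CycleAdj k) (map proj₁ ps) → Colouring (weightOf ps) (stable ps)
  colouring-from : ∀ v a ps → Linked (CycleAdj k) (v ∷ map proj₁ ps) →
                   Colouring (weightOf ((v , a) ∷ ps)) (stable ((v , a) ∷ ps))

  path-colouring []             _      = [] , [] , (λ _ → z≤n) , z≤n
  path-colouring ((v , a) ∷ ps) linked = colouring-from v a ps linked

  colouring-from v a [] _ =
    replicate a (single v) , Allₚ.replicate⁺ a tt ,
    (λ x → ≤-reflexive (trans (+-identityʳ _) (sym (loads-replicate a (single v) x)))) ,
    ≤-reflexive (length-replicate a)
  colouring-from v a ((u , b) ∷ ps) (v~u ∷ linked) with b ≤? a
  ... | yes b≤a = Colouring-mono (m≤m⊔n _ _) (absorb-next {ps = ps} v~u b≤a (path-colouring ps (Linked.tail linked)))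
  ... | no  b≰a = Colouring-mono (stable-shift v u ps a≤b) (pass-on {ps = ps} v~u a≤b (colouring-from u (b ∸ a) ps linked))
    where a≤b = <⇒≤ (≰⇒> b≰a)

  weighted-classes : ∀ (w : Fin k → ℕ) vs → map proj₁ (weighted w vs) ≡ vs
  weighted-classes w vs = trans (sym (map-∘ vs)) (map-id vs)

  colouring-along : ∀ (w : Fin k → ℕ) vs → Linked (CycleAdj k) vs → (∀ x → x ∈ vs ⊎ w x ≡ 0) →
                    Colouring w (stable (weighted w vs))
  colouring-along w vs linked covered =
    let L , ok , covers , size = path-colouring (weighted w vs)
                                   (subst (Linked (CycleAdj k)) (sym (weighted-classes w vs)) linked)
    in L , ok , (λ x → Sum.[ (λ x∈vs → ≤-trans (weightOf-∈ w x∈vs) (covers x)) ,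
                             (λ wx≡0 → subst (_≤ loads L x) (sym wx≡0) z≤n) ] (covered x)) , size

  clique-along : ∀ (w : Fin k → ℕ) vs → Chordless vs → Unique vs → Clique w (stable (weighted w vs))
  clique-along w vs chordless distinct =
    let qs , qs⊆ps , apart , mass≡ = stable-clique (weighted w vs)
                                       (subst Chordless (sym (weighted-classes w vs)) chordless)
    in qs , apart ,
       (λ x → ≤-trans (weightOf-⊆ qs⊆ps x)
                (weightOf-≤ (weighted w vs) (AllPairsₚ.map⁺ distinct) (Allₚ.map⁺ (All.universal (λ _ → ≤-refl) vs)) x)) ,
       ≤-reflexive (sym mass≡)

record Automorphism (k : ℕ) : Set where
  field
    to from : Fin k → Fin k
    to-from : ∀ x → to (from x) ≡ x
    from-to : ∀ x → from (to x) ≡ x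
    adj⁺    : ∀ {a b} → CycleAdj k a b → CycleAdj k (to a) (to b)
    adj⁻    : ∀ {a b} → CycleAdj k (to a) (to b) → CycleAdj k a b

module _ {k : ℕ} where

  idᴬ : Automorphism k
  idᴬ = record { to = λ x → x ; from = λ x → x ; to-from = λ _ → refl ; from-to = λ _ → refl
               ; adj⁺ = λ adj → adj ; adj⁻ = λ adj → adj }

  _∘ᴬ_ : Automorphism k → Automorphism k → Automorphism k
  σ ∘ᴬ τ = record
    { to      = σ.to ∘ τ.to
    ; from    = τ.from ∘ σ.from
    ; to-from = λ x → trans (cong σ.to (τ.to-from (σ.from x))) (σ.to-from x)
    ; from-to = λ x → trans (cong τ.from (σ.from-to (τ.to x))) (τ.from-to x)
    ; adj⁺    = σ.adj⁺ ∘ τ.adj⁺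
    ; adj⁻    = τ.adj⁻ ∘ σ.adj⁻
    }
    where module σ = Automorphism σ; module τ = Automorphism τ

module Transport {k : ℕ} (σ : Automorphism k) where
  open Automorphism σ

  mapShape : Shape k → Shape k
  mapShape (single a) = single (to a)
  mapShape (pair a b) = pair (to a) (to b)

  indicator-to : ∀ a x → indicator (to a) x ≡ indicator a (from x)
  indicator-to a x with to a Finₚ.≟ x | a Finₚ.≟ from x
  ... | yes _    | yes _    = refl
  ... | no _     | no _     = refl
  ... | yes refl | no a≢    = contradiction (sym (from-to a)) a≢
  ... | no ≢x    | yes refl = contradiction (to-from x) ≢x

  loads-map : ∀ L x → loads (map mapShape L) x ≡ loads L (from x)
  loads-map []             x = refl
  loads-map (single a ∷ L) x = cong₂ _+_ (indicator-to a x) (loads-map L x)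
  loads-map (pair a b ∷ L) x = cong₂ _+_ (cong₂ _+_ (indicator-to a x) (indicator-to b x)) (loads-map L x)

  ∈ₛ-map : ∀ {a} s → a ∈ₛ s → to a ∈ₛ mapShape s
  ∈ₛ-map (single b) refl        = refl
  ∈ₛ-map (pair b c) (inj₁ refl) = inj₁ refl
  ∈ₛ-map (pair b c) (inj₂ refl) = inj₂ refl

  colours-map : ∀ {L} → All IsColourClass L → All IsColourClass (map mapShape L)
  colours-map {[]}           []         = []
  colours-map {single _ ∷ L} (_   ∷ ok) = tt ∷ colours-map ok
  colours-map {pair _ _ ∷ L} (adj ∷ ok) = adj⁺ adj ∷ colours-map ok

  branches-map : ∀ {B} → All IsBranchSet B → All IsBranchSet (map mapShape B)
  branches-map {[]}           []          = []
  branches-map {single _ ∷ B} (_    ∷ ok) = tt ∷ branches-map ok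
  branches-map {pair _ _ ∷ B} (¬adj ∷ ok) = ¬adj ∘ adj⁻ ∷ branches-map ok

  touches-map : ∀ {s t} → Touches s t → Touches (mapShape s) (mapShape t)
  touches-map {s} {t} (a , b , a∈s , b∈t , ¬adj) = to a , to b , ∈ₛ-map s a∈s , ∈ₛ-map t b∈t , ¬adj ∘ adj⁻

  transport : ∀ {w} → Certificate (w ∘ to) → Certificate w
  transport {w} C = record
    { colours       = map mapShape colours
    ; branches      = map mapShape branches
    ; colours-ok    = colours-map colours-ok
    ; branches-ok   = branches-map branches-ok
    ; covers        = λ x → subst₂ _≤_ (cong w (to-from x)) (sym (loads-map colours x)) (covers (from x))
    ; fits          = λ x → subst₂ _≤_ (sym (loads-map branches x)) (cong w (to-from x)) (fits (from x))
    ; touching      = AllPairsₚ.map⁺ (AllPairs.map touches-map (Certificate.touching C))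
    ; fewer-colours = subst₂ _≤_ (sym (length-map mapShape colours)) (sym (length-map mapShape branches))
                        fewer-colours
    }
    where open Certificate C hiding (touching)

module _ {n : ℕ} where

  private
    k = suc n

  next : Fin k → Fin k
  next x with suc (toℕ x) <? k
  ... | yes x+1<k = fromℕ< x+1<k
  ... | no  _     = zero

  toℕ-next : ∀ x → suc (toℕ x) < k → toℕ (next x) ≡ suc (toℕ x)
  toℕ-next x x+1<k with suc (toℕ x) <? k
  ... | yes x+1<k′ = toℕ-fromℕ< x+1<k′
  ... | no  x+1≮k  = contradiction x+1<k x+1≮k

  next-last : ∀ x → suc (toℕ x) ≡ k → next x ≡ zero
  next-last x x+1≡k with suc (toℕ x) <? k
  ... | yes x+1<k = contradiction x+1≡k (<⇒≢ x+1<k)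
  ... | no  _     = refl

  next-suc : ∀ {a b : Fin k} → suc (toℕ a) ≡ toℕ b → next a ≡ b
  next-suc {a} {b} e = toℕ-injective (trans (toℕ-next a (subst (_< k) (sym e) (toℕ<n b))) e)

  next-wrap : ∀ {a b : Fin k} → suc (toℕ a) ≡ k → toℕ b ≡ 0 → next a ≡ b
  next-wrap {a} {b} a+1≡k b≡0 = toℕ-injective (trans (cong toℕ (next-last a a+1≡k)) (sym b≡0))

  cycleAdj-next : ∀ x → CycleAdj k x (next x)
  cycleAdj-next x with suc (toℕ x) <? k
  ... | yes x+1<k = inj₁ (sym (toℕ-fromℕ< x+1<k))
  ... | no  x+1≮k = inj₂ (inj₂ (inj₂ (refl , ≤-antisym (toℕ<n x) (≮⇒≥ x+1≮k))))

  cycleAdj⇒next : ∀ {a b} → CycleAdj k a b → next a ≡ b ⊎ next b ≡ a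
  cycleAdj⇒next (inj₁ e)                             = inj₁ (next-suc e)
  cycleAdj⇒next (inj₂ (inj₁ e))                      = inj₂ (next-suc e)
  cycleAdj⇒next (inj₂ (inj₂ (inj₁ (a≡0 , b+1≡k)))) = inj₂ (next-wrap b+1≡k a≡0)
  cycleAdj⇒next (inj₂ (inj₂ (inj₂ (b≡0 , a+1≡k)))) = inj₁ (next-wrap a+1≡k b≡0)

  next⇒cycleAdj : ∀ {a b} → next a ≡ b ⊎ next b ≡ a → CycleAdj k a b
  next⇒cycleAdj (inj₁ refl) = cycleAdj-next _
  next⇒cycleAdj (inj₂ refl) = cycleAdj-sym (cycleAdj-next _)

  next-injective : ∀ {a b} → next a ≡ next b → a ≡ b
  next-injective {a} {b} e with suc (toℕ a) <? k | suc (toℕ b) <? k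
  ... | yes a+1<k | yes b+1<k = toℕ-injective (suc-injective
                                  (trans (sym (toℕ-fromℕ< a+1<k)) (trans (cong toℕ e) (toℕ-fromℕ< b+1<k))))
  ... | no  a+1≮k | no  b+1≮k = toℕ-injective (suc-injective
                                  (trans (≤-antisym (toℕ<n a) (≮⇒≥ a+1≮k)) (sym (≤-antisym (toℕ<n b) (≮⇒≥ b+1≮k)))))
  ... | yes a+1<k | no  _     = contradiction (trans (sym (toℕ-fromℕ< a+1<k)) (cong toℕ e)) λ ()
  ... | no  _     | yes b+1<k = contradiction (trans (sym (toℕ-fromℕ< b+1<k)) (cong toℕ (sym e))) λ ()

  prev : Fin k → Fin k
  prev zero    = Fin.fromℕ n
  prev (suc y) = Fin.inject₁ y

  next-prev : ∀ x → next (prev x) ≡ x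
  next-prev zero    = next-last (Fin.fromℕ n) (cong suc (Finₚ.toℕ-fromℕ n))
  next-prev (suc y) = next-suc (cong suc (Finₚ.toℕ-inject₁ y))

  nextᴬ : Automorphism k
  nextᴬ = record
    { to      = next
    ; from    = prev
    ; to-from = next-prev
    ; from-to = λ x → next-injective (next-prev (next x))
    ; adj⁺    = next⇒cycleAdj ∘ Sum.map (cong next) (cong next) ∘ cycleAdj⇒next
    ; adj⁻    = next⇒cycleAdj ∘ Sum.map next-injective next-injective ∘ cycleAdj⇒next
    }

  rotation : ℕ → Automorphism k
  rotation zero    = idᴬ
  rotation (suc r) = rotation r ∘ᴬ nextᴬ

  toℕ-rotation : ∀ r x → r + toℕ x < k → toℕ (Automorphism.to (rotation r) x) ≡ r + toℕ x
  toℕ-rotation zero    x _ = refl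
  toℕ-rotation (suc r) x r+1+x<k =
    trans (toℕ-rotation r (next x) (subst (λ m → r + m < k) (sym x+1≡) (subst (_< k) (sym (+-suc r _)) r+1+x<k)))
          (trans (cong (r +_) x+1≡) (+-suc r (toℕ x)))
    where
    x+1≡ : toℕ (next x) ≡ suc (toℕ x)
    x+1≡ = toℕ-next x (≤-<-trans (s≤s (m≤n+m (toℕ x) r)) r+1+x<k)

  rotate : ℕ → Fin k → Fin k
  rotate r = Automorphism.to (rotation r)

  rotate-next : ∀ r x → rotate r (next x) ≡ next (rotate r x)
  rotate-next zero    x = refl
  rotate-next (suc r) x = rotate-next r (next x)

  rotate-comm : ∀ r s x → rotate r (rotate s x) ≡ rotate s (rotate r x)
  rotate-comm r zero    x = refl
  rotate-comm r (suc s) x = trans (rotate-comm r s (next x)) (cong (rotate s) (rotate-next r x))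

  rotation-zero : ∀ a → Automorphism.to (rotation (toℕ a)) zero ≡ a
  rotation-zero a = toℕ-injective (trans (toℕ-rotation (toℕ a) zero (subst (_< k) (sym (+-identityʳ _)) (toℕ<n a)))
                                         (+-identityʳ (toℕ a)))

module _ {n : ℕ} where

  private
    k = suc n

  at : ℕ → Fin k
  at i = i mod k

  toℕ-at : ∀ {i} → i < k → toℕ (at i) ≡ i
  toℕ-at i<k = trans (toℕ-fromℕ< _) (m<n⇒m%n≡m i<k)

  segment : ℕ → ℕ → List (Fin k)
  segment i zero    = []
  segment i (suc m) = at i ∷ segment (suc i) m

  segment⁺ : ∀ {P : Fin k → Set} i m → (∀ j → i ≤ j → j < i + m → P (at j)) → All P (segment i m)
  segment⁺ i zero    _ = []
  segment⁺ i (suc m) P = P i ≤-refl (m<m+n i (s≤s z≤n))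
                       ∷ segment⁺ (suc i) m (λ j i<j j< → P j (<⇒≤ i<j) (subst (j <_) (sym (+-suc i m)) j<))

  segment-∈ : ∀ {x} i m → i ≤ toℕ x → toℕ x < i + m → x ∈ segment i m
  segment-∈ {x} i zero    i≤x x< = contradiction x< (≤⇒≯ (≤-trans (≤-reflexive (+-identityʳ i)) i≤x))
  segment-∈ {x} i (suc m) i≤x x< with i ≟ toℕ x
  ... | yes refl = here (toℕ-injective (sym (toℕ-at (toℕ<n x))))
  ... | no  i≢x  = there (segment-∈ (suc i) m (≤∧≢⇒< i≤x i≢x) (subst (toℕ x <_) (+-suc i m) x<))

  segment-linked : ∀ i m → i + m ≤ n → Linked (CycleAdj k) (segment i m)
  segment-linked i zero          _ = []
  segment-linked i (suc zero)    _ = [-]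
  segment-linked i (suc (suc m)) i+m+2≤n =
    inj₁ (trans (cong suc (toℕ-at i<k)) (sym (toℕ-at i+1<k)))
    ∷ segment-linked (suc i) (suc m) (subst (_≤ n) (+-suc i (suc m)) i+m+2≤n)
    where
    i+1<k : suc i < k
    i+1<k = s≤s (≤-trans (s≤s (m≤m+n i (suc m))) (subst (_≤ n) (+-suc i (suc m)) i+m+2≤n))
    i<k : i < k
    i<k = <-trans (n<1+n i) i+1<k

  segment-chordless : ∀ i m → i + m ≤ n → Chordless (segment i m)
  segment-chordless i zero          _ = []
  segment-chordless i (suc zero)    _ = [-]
  segment-chordless i (suc (suc m)) i+m+2≤n =
    segment⁺ (suc (suc i)) m (λ j i+2≤j j< → far j i+2≤j (<-≤-trans (subst (j <_) i+m+2≡ j<) i+m+2≤n))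
    ∷ segment-chordless (suc i) (suc m) (subst (_≤ n) (+-suc i (suc m)) i+m+2≤n)
    where
    i+m+2≡ : suc (suc (i + m)) ≡ i + suc (suc m)
    i+m+2≡ = sym (trans (+-suc i (suc m)) (cong suc (+-suc i m)))
    far : ∀ j → suc (suc i) ≤ j → j < n → ¬ CycleAdj k (at i) (at j)
    far j i+2≤j j<n adj
      with toℕ (at i) | toℕ-at {i} (<-trans (<-trans (≤-trans (n≤1+n (suc i)) i+2≤j) j<n) (n<1+n n))
         | toℕ (at j) | toℕ-at {j} (<-trans j<n (n<1+n n))
    far j i+2≤j j<n (inj₁ refl)                     | _ | refl | _ | refl = 1+n≰n i+2≤j
    far j i+2≤j j<n (inj₂ (inj₁ refl))              | _ | refl | _ | refl = 1+n≰n (≤-trans (≤-trans (n≤1+n _) (n≤1+n _)) i+2≤j)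
    far j i+2≤j j<n (inj₂ (inj₂ (inj₁ (_ , refl)))) | _ | refl | _ | refl = 1+n≰n j<n
    far j i+2≤j j<n (inj₂ (inj₂ (inj₂ (refl , _)))) | _ | refl | _ | refl = contradiction i+2≤j λ ()

  segment-unique : ∀ i m → i + m ≤ suc n → Unique (segment i m)
  segment-unique i zero    _ = []
  segment-unique i (suc m) i+m+1≤k =
    segment⁺ (suc i) m (λ j i<j j< same → <⇒≢ i<j (trans (sym (toℕ-at i<k)) (trans (cong toℕ same) (toℕ-at (<-≤-trans j< i+m+1≤k′)))))
    ∷ segment-unique (suc i) m i+m+1≤k′
    where
    i+m+1≤k′ : suc i + m ≤ k
    i+m+1≤k′ = subst (_≤ k) (+-suc i m) i+m+1≤k
    i<k : i < k
    i<k = ≤-trans (s≤s (m≤m+n i m)) i+m+1≤k′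

  zero-at-last-certificate : 3 ≤ k → (w : Fin k → ℕ) → w (Fin.fromℕ n) ≡ 0 → Certificate w
  zero-at-last-certificate 3≤k w w-last≡0 =
    colouring+clique⇒certificate 3≤k
      (colouring-along w (segment 0 n) (segment-linked 0 n ≤-refl) covered)
      (clique-along w (segment 0 n) (segment-chordless 0 n ≤-refl) (segment-unique 0 n (n≤1+n n)))
    where
    covered : ∀ x → x ∈ segment 0 n ⊎ w x ≡ 0
    covered x with toℕ x <? n
    ... | yes x<n = inj₁ (segment-∈ 0 n z≤n x<n)
    ... | no  x≮n = inj₂ (trans (cong w (toℕ-injective (trans (≤-antisym (s≤s⁻¹ (toℕ<n x)) (≮⇒≥ x≮n))
                                                              (sym (Finₚ.toℕ-fromℕ n))))) w-last≡0)

  certificate-with-zero : 3 ≤ k → (w : Fin k → ℕ) (z : Fin k) → w z ≡ 0 → Certificate w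
  certificate-with-zero 3≤k w z wz≡0 = Transport.transport ρ (zero-at-last-certificate 3≤k (w ∘ to ρ) last↦z)
    where
    ρ = rotation (suc (toℕ z))
    open Automorphism using (to)
    last↦z : w (to ρ (Fin.fromℕ n)) ≡ 0
    last↦z = trans (cong (w ∘ to (rotation (toℕ z))) (next-last (Fin.fromℕ n) (cong suc (Finₚ.toℕ-fromℕ n))))
                   (trans (cong w (rotation-zero z)) wz≡0)

pair-dominates : ∀ {k} {p q : Fin k} {u} → (∀ a → CycleAdj k a p → ¬ CycleAdj k a q) → Dominates (pair p q) u
pair-dominates {k} {p} {q} apart a _ with cycleAdj? a p
... | yes a~p = q , inj₂ refl , apart a a~p
... | no  a≁p = p , inj₁ refl , a≁p

-- For k ≥ 6 and positive weights, colour one vertex of each of the classes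
-- 0, 1, 3, 4 with the colour classes {0,1}, {3,4} and use them for the branch
-- sets {0,3}, {1,4}.  No class is cycle-adjacent to both 0 and 3, or to both
-- 1 and 4, so these branch sets touch every vertex that is left.
module _ {m : ℕ} where

  private
    k = 6 + m
    c₀ c₁ c₃ c₄ : Fin k
    c₀ = zero
    c₁ = suc zero
    c₃ = suc (suc (suc zero))
    c₄ = suc (suc (suc (suc zero)))

    apart₀₃ : ∀ a → CycleAdj k a c₀ → ¬ CycleAdj k a c₃
    apart₀₃ a a~c₀ a~c₃ with cycleAdj⇒next a~c₀ | cycleAdj⇒next a~c₃
    ... | inj₁ a↦c₀ | inj₁ a↦c₃ = contradiction (trans (sym a↦c₀) a↦c₃) λ ()
    ... | inj₁ a↦c₀ | inj₂ refl = contradiction a↦c₀ λ ()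
    ... | inj₂ refl | inj₁ ()
    ... | inj₂ refl | inj₂ ()

    apart₁₄ : ∀ a → CycleAdj k a c₁ → ¬ CycleAdj k a c₄
    apart₁₄ a a~c₁ a~c₄ with cycleAdj⇒next a~c₁ | cycleAdj⇒next a~c₄
    ... | inj₁ a↦c₁ | inj₁ a↦c₄ = contradiction (trans (sym a↦c₁) a↦c₄) λ ()
    ... | inj₁ a↦c₁ | inj₂ refl = contradiction (next-injective {a = c₀} {b = next c₄} (sym a↦c₁)) λ ()
    ... | inj₂ refl | inj₁ ()
    ... | inj₂ refl | inj₂ ()

    rearrange : ∀ a b c d → (a + b) + ((c + d) + 0) ≡ 1 * a + (1 * b + (1 * c + (1 * d + 0)))
    rearrange = solve-∀

    swap-middle : ∀ a b c d → (a + c) + ((b + d) + 0) ≡ (a + b) + ((c + d) + 0)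
    swap-middle = solve-∀

  reduction₆₊ : (w : Fin k → ℕ) → (∀ x → 0 < w x) → Reduction w
  reduction₆₊ w positive = record
    { colours       = pair c₀ c₁ ∷ pair c₃ c₄ ∷ []
    ; branches      = pair c₀ c₃ ∷ pair c₁ c₄ ∷ []
    ; colours-ok    = inj₁ refl ∷ inj₁ refl ∷ []
    ; branches-ok   = ¬cycleAdj c₀ c₃ ∷ ¬cycleAdj c₁ c₄ ∷ []
    ; colours-fit   = λ x → subst (_≤ w x) (sym (rearrange (indicator c₀ x) (indicator c₁ x) (indicator c₃ x) (indicator c₄ x)))
                        (weightOf-≤ {w = w} ((c₀ , 1) ∷ (c₁ , 1) ∷ (c₃ , 1) ∷ (c₄ , 1) ∷ [])
                           (((λ ()) ∷ (λ ()) ∷ (λ ()) ∷ []) ∷ ((λ ()) ∷ (λ ()) ∷ []) ∷ ((λ ()) ∷ []) ∷ [] ∷ [])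
                           (positive c₀ ∷ positive c₁ ∷ positive c₃ ∷ positive c₄ ∷ []) x)
    ; branches-fit  = λ x → ≤-reflexive (swap-middle (indicator c₀ x) (indicator c₁ x) (indicator c₃ x) (indicator c₄ x))
    ; touching      = ((c₃ , c₁ , inj₂ refl , inj₁ refl , ¬cycleAdj c₃ c₁) ∷ []) ∷ [] ∷ []
    ; dominating    = pair-dominates apart₀₃ ∷ pair-dominates apart₁₄ ∷ []
    ; fewer-colours = ≤-refl
    }

  certificate₆₊ : (w : Fin k → ℕ) → Certificate w
  certificate₆₊ w = by-weight-of-c₀ (w c₀) w ≤-refl
    where
    by-weight-of-c₀ : ∀ n (w : Fin k → ℕ) → w c₀ ≤ n → Certificate w
    by-weight-of-c₀ n w w₀≤n with Finₚ.any? (λ x → w x ≟ 0)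
    ... | yes (z , wz≡0) = certificate-with-zero (s≤s (s≤s (s≤s z≤n))) w z wz≡0
    by-weight-of-c₀ zero    w w₀≤0 | no none = contradiction (n≤0⇒n≡0 w₀≤0) (λ w₀≡0 → none (c₀ , w₀≡0))
    by-weight-of-c₀ (suc n) w w₀≤n | no none =
      extend R (by-weight-of-c₀ n (Reduction.remainder R) (∸-monoˡ-≤ 1 w₀≤n))
      where
      R = reduction₆₊ w (λ x → n≢0⇒n>0 (λ wx≡0 → none (x , wx≡0)))

cycleAdj₃ : (x y : Fin 3) → x ≢ y → CycleAdj 3 x y
cycleAdj₃ = toWitness {a? = Finₚ.all? λ x → Finₚ.all? λ y → ¬? (x Finₚ.≟ y) →-dec cycleAdj? x y} tt

-- For k = 3 any three vertices from distinct classes are pairwise non-adjacent.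
some-class-empty₃ : (c : Fin 3 → ℕ) → IndependenceNumber (InflatedComplementCycle 3 c) 2 → ∃[ z ] c z ≡ 0
some-class-empty₃ c (_ , α≤2) with Finₚ.any? (λ x → c x ≟ 0)
... | yes found = found
... | no  none  = contradiction (α≤2 S (distinct , independent)) λ { (s≤s (s≤s ())) }
  where
  G = InflatedComplementCycle 3 c
  vertex : Fin 3 → V G
  vertex x = x , fromℕ< (n≢0⇒n>0 (λ cx≡0 → none (x , cx≡0)))
  S : List (V G)
  S = vertex zero ∷ vertex (suc zero) ∷ vertex (suc (suc zero)) ∷ []
  distinct : Unique S
  distinct = ((λ ()) ∘ cong proj₁ ∷ (λ ()) ∘ cong proj₁ ∷ []) ∷ ((λ ()) ∘ cong proj₁ ∷ []) ∷ [] ∷ []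
  member : ∀ {u} → u ∈ S → ∃[ x ] u ≡ vertex x
  member (here refl)                 = _ , refl
  member (there (here refl))         = _ , refl
  member (there (there (here refl))) = _ , refl
  non-adjacent : ∀ x y → ¬ Adj G (vertex x) (vertex y)
  non-adjacent x y (u≢v , same-or-far) with x Finₚ.≟ y | same-or-far
  ... | yes refl | _                = u≢v refl
  ... | no  x≢y  | inj₁ x≡y         = x≢y x≡y
  ... | no  x≢y  | inj₂ (_ , ¬adj) = ¬adj (cycleAdj₃ x y x≢y)
  independent : ∀ {u v} → u ∈ S → v ∈ S → ¬ Adj G u v
  independent u∈S v∈S with member u∈S | member v∈S
  ... | x , refl | y , refl = non-adjacent x y

halve : ∀ n → ∃[ h ] ∃[ e ] e ≤ 1 × n + e ≡ h + h
halve zero          = 0 , 0 , z≤n , refl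
halve (suc zero)    = 1 , 1 , ≤-refl , refl
halve (suc (suc n)) = let h , e , e≤1 , n+e≡h+h = halve n in
  suc h , e , e≤1 , cong suc (trans (cong suc n+e≡h+h) (sym (+-suc h h)))

half-≤ : ∀ {x y} → x + x ≤ suc (y + y) → x ≤ y
half-≤ {x} {y} x+x≤ = ≮⇒≥ λ y<x → 1+n≰n (subst (_≤ y + y) (+-suc y y) (s≤s⁻¹ (≤-trans (+-mono-≤ y<x y<x) x+x≤)))

m⊓n+m⊔n≡m+n : ∀ m n → m ⊓ n + (m ⊔ n) ≡ m + n
m⊓n+m⊔n≡m+n m n with ≤-total m n
... | inj₁ m≤n = cong₂ _+_ (m≤n⇒m⊓n≡m m≤n) (m≤n⇒m⊔n≡n m≤n)
... | inj₂ n≤m = trans (cong₂ _+_ (m≥n⇒m⊓n≡n n≤m) (m≥n⇒m⊔n≡m n≤m)) (+-comm n m)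

≤⊔-of-sum : ∀ {x y p q} → x ≤ y → x + y ≡ p + q → x ≤ p ⊔ q
≤⊔-of-sum {x} {y} {p} {q} x≤y x+y≡p+q = ≮⇒≥ λ p⊔q<x → <-irrefl (sym x+y≡p+q) (begin-strict
  p + q               ≤⟨ +-mono-≤ (m≤m⊔n p q) (m≤n⊔m p q) ⟩
  (p ⊔ q) + (p ⊔ q)   <⟨ +-mono-<-≤ p⊔q<x (≤-trans (<⇒≤ p⊔q<x) x≤y) ⟩
  x + y               ∎)
  where open ≤-Reasoning

exchange-< : ∀ {x y z W} → x + W < y + z → z ≤ W → x + z ≤ W + y
exchange-< {x} {y} {z} {W} x+W<y+z z≤W = subst (x + z ≤_) (+-comm y W)
  (<⇒≤ (+-mono-<-≤ (+-cancelʳ-< _ x y (<-≤-trans x+W<y+z (+-monoʳ-≤ y z≤W))) z≤W))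

resolve-⊔-⊓ : ∀ {W p q r s a b c d} → p ⊔ r ≡ a → q ⊔ s ≡ b → p ⊓ r ≡ c → q ⊓ s ≡ d →
              a + b ≤ W + (c + d) → (p ⊔ r) + (q ⊔ s) ≤ W + ((p ⊓ r) + (q ⊓ s))
resolve-⊔-⊓ refl refl refl refl le = le

-- The inequalities behind the balanced model of the inflation of C₅ below.
balance : ∀ {W p q r s} → p ≤ W → r ≤ W → s ≤ W →
          W + q < p + (r + s) → r + W < s + (p + q) → s + p < W + (q + r) →
          (p ⊔ r) + (q ⊔ s) ≤ W + ((p ⊓ r) + (q ⊓ s))
balance {W} {p} {q} {r} {s} p≤W r≤W s≤W light₀ light₃ light₄ with ≤-total p r | ≤-total q s
... | inj₁ p≤r | inj₁ q≤s = resolve-⊔-⊓ {W} (m≤n⇒m⊔n≡n p≤r) (m≤n⇒m⊔n≡n q≤s) (m≤n⇒m⊓n≡m p≤r) (m≤n⇒m⊓n≡m q≤s)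
      (exchange-< (subst (r + W <_) (+-comm s (p + q)) light₃) s≤W)
... | inj₁ p≤r | inj₂ s≤q = resolve-⊔-⊓ {W} (m≤n⇒m⊔n≡n p≤r) (m≥n⇒m⊔n≡m s≤q) (m≤n⇒m⊓n≡m p≤r) (m≥n⇒m⊓n≡n s≤q)
      (subst (_≤ W + (p + s)) (+-comm q r) (exchange-< (subst₂ _<_ (+-comm W q) (x+[y+z]≡[x+z]+y p r s) light₀) r≤W))
  where
  x+[y+z]≡[x+z]+y : ∀ x y z → x + (y + z) ≡ (x + z) + y
  x+[y+z]≡[x+z]+y = solve-∀
... | inj₂ r≤p | inj₁ q≤s = resolve-⊔-⊓ {W} (m≥n⇒m⊔n≡m r≤p) (m≤n⇒m⊔n≡n q≤s) (m≥n⇒m⊓n≡n r≤p) (m≤n⇒m⊓n≡m q≤s)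
      (<⇒≤ (subst₂ _<_ (+-comm s p) (cong (W +_) (+-comm q r)) light₄))
... | inj₂ r≤p | inj₂ s≤q = resolve-⊔-⊓ {W} (m≥n⇒m⊔n≡m r≤p) (m≥n⇒m⊔n≡m s≤q) (m≥n⇒m⊓n≡n r≤p) (m≥n⇒m⊓n≡n s≤q)
      (subst (_≤ W + (r + s)) (+-comm q p) (exchange-< (subst₂ _<_ (+-comm W q) (+-comm p (r + s)) light₀) p≤W))

-- The inflation is the disjoint union of the cliques C₀ ∪ C₂ and C₁ ∪ C₃.  A
-- Hamiltonian path of C₄ avoiding a lightest pair of opposite edges has no
-- independent set heavier than these cliques.
module _ where

  private
    c₀ c₁ c₂ c₃ : Fin 4
    c₀ = zero
    c₁ = suc zero
    c₂ = suc (suc zero)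
    c₃ = suc (suc (suc zero))

    3≤4 : 3 ≤ 4
    3≤4 = s≤s (s≤s (s≤s z≤n))

    Ω₄ : (Fin 4 → ℕ) → ℕ
    Ω₄ w = (w c₀ + w c₂) ⊔ (w c₁ + w c₃)

    path₄-stable : ∀ a b c d → a + d ≤ b + c →
                   (a + ((c + 0) ⊔ d)) ⊔ ((b + d) ⊔ ((c + 0) ⊔ d)) ≤ (d + b) ⊔ (a + c)
    path₄-stable a b c d a+d≤b+c =
      ⊔-lub (subst (_≤ M) (sym (+-distribˡ-⊔ a (c + 0) d))
               (⊔-lub (subst (λ c′ → a + c′ ≤ M) (sym (+-identityʳ c)) (m≤n⊔m _ _))
                      (≤⊔-of-sum {p = d + b} {q = a + c} a+d≤b+c (exchange a b c d))))
      (⊔-lub (subst (_≤ M) (+-comm d b) (m≤m⊔n _ _))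
      (⊔-lub (subst (_≤ M) (sym (+-identityʳ c)) (≤-trans (m≤n+m c a) (m≤n⊔m _ _)))
             (≤-trans (m≤m+n d b) (m≤m⊔n _ _))))
      where
      M = (d + b) ⊔ (a + c)
      exchange : ∀ a b c d → (a + d) + (b + c) ≡ (d + b) + (a + c)
      exchange = solve-∀

    clique₄ : (w : Fin 4 → ℕ) → Clique w (Ω₄ w)
    clique₄ w with w c₁ + w c₃ ≤? w c₀ + w c₂
    ... | yes B≤A = Clique-mono (≤-reflexive (m≥n⇒m⊔n≡m B≤A)) (clique-pair w (λ ()) (¬cycleAdj c₀ c₂))
    ... | no  B≰A = Clique-mono (≤-reflexive (m≤n⇒m⊔n≡n (<⇒≤ (≰⇒> B≰A)))) (clique-pair w (λ ()) (¬cycleAdj c₁ c₃))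

    certificate₄-normalised : (w : Fin 4 → ℕ) → w c₁ + w c₀ ≤ w c₂ + w c₃ → Certificate w
    certificate₄-normalised w light =
      colouring+clique⇒certificate 3≤4
        (Colouring-mono (path₄-stable (w c₁) (w c₂) (w c₃) (w c₀) light)
          (colouring-along w (c₁ ∷ c₂ ∷ c₃ ∷ c₀ ∷ []) (inj₁ refl ∷ inj₁ refl ∷ inj₂ (inj₂ (inj₂ (refl , refl))) ∷ [-])
                           (inj₁ ∘ every-class)))
        (clique₄ w)
      where
      every-class : ∀ x → x ∈ c₁ ∷ c₂ ∷ c₃ ∷ c₀ ∷ []
      every-class zero                   = there (there (there (here refl)))
      every-class (suc zero)             = here refl
      every-class (suc (suc zero))       = there (here refl)
      every-class (suc (suc (suc zero))) = there (there (here refl))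

  certificate₄ : (w : Fin 4 → ℕ) → Certificate w
  certificate₄ w with w c₁ + w c₀ ≤? w c₂ + w c₃
  ... | yes light = certificate₄-normalised w light
  ... | no  heavy = Transport.transport (rotation 2) (certificate₄-normalised (w ∘ Automorphism.to (rotation 2))
                      (subst₂ _≤_ (+-comm (w c₂) (w c₃)) (+-comm (w c₁) (w c₀)) (<⇒≤ (≰⇒> heavy))))

maximiser : ∀ {n} (f : Fin (suc n) → ℕ) → ∃[ a ] (∀ x → f x ≤ f a)
maximiser f = argmax f zero (allFin _) , λ x → All.lookup (f[xs]≤f[argmax] {f = f} zero (allFin _)) (∈-allFin x)

-- The complement of C₅ is again a 5-cycle, in which a is adjacent to a + 2:
-- the maximal cliques of the inflation are C_a ∪ C_(a+2), and the remaining
-- classes a + 1, a + 3, a + 4 hold the rest of the vertices.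
module _ where

  private
    c₀ c₁ c₂ c₃ c₄ : Fin 5
    c₀ = zero
    c₁ = suc zero
    c₂ = suc (suc zero)
    c₃ = suc (suc (suc zero))
    c₄ = suc (suc (suc (suc zero)))

    3≤5 : 3 ≤ 5
    3≤5 = s≤s (s≤s (s≤s z≤n))

    every-class₅ : ∀ x → x ∈ c₀ ∷ c₁ ∷ c₂ ∷ c₃ ∷ c₄ ∷ []
    every-class₅ zero                         = here refl
    every-class₅ (suc zero)                   = there (here refl)
    every-class₅ (suc (suc zero))             = there (there (here refl))
    every-class₅ (suc (suc (suc zero)))       = there (there (there (here refl)))
    every-class₅ (suc (suc (suc (suc zero)))) = there (there (there (there (here refl))))

  cl : (Fin 5 → ℕ) → Fin 5 → ℕ
  cl w a = w a + w (rotate 2 a)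

  rest : (Fin 5 → ℕ) → Fin 5 → ℕ
  rest w a = w (rotate 1 a) + (w (rotate 3 a) + w (rotate 4 a))

  cl-rotate : ∀ w r a → cl (w ∘ rotate r) a ≡ cl w (rotate r a)
  cl-rotate w r a = cong (λ y → w (rotate r a) + w y) (rotate-comm r 2 a)

  rest-rotate : ∀ w r a → rest (w ∘ rotate r) a ≡ rest w (rotate r a)
  rest-rotate w r a = cong₂ (λ y z → w y + z) (rotate-comm r 1 a)
                        (cong₂ (λ y z → w y + w z) (rotate-comm r 3 a) (rotate-comm r 4 a))

  private
    path₅-stable : ∀ {a b c d e} → c + (a + e) ≤ d + b → a + d ≤ d + b → b + e ≤ d + b → e + c ≤ d + b →
                   (a + ((c + e) ⊔ ((d + 0) ⊔ e))) ⊔ ((b + ((d + 0) ⊔ e)) ⊔ ((c + e) ⊔ ((d + 0) ⊔ e))) ≤ d + b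
    path₅-stable {a} {b} {c} {d} {e} rest≤ cl₃≤ cl₂≤ cl₄≤ = ⊔-lub a+X≤ (⊔-lub b+Y≤ X≤)
      where
      M = d + b
      e≤ : e ≤ M
      e≤ = ≤-trans (m≤n+m e b) cl₂≤
      Y≤ : (d + 0) ⊔ e ≤ M
      Y≤ = ⊔-lub (≤-trans (≤-reflexive (+-identityʳ d)) (m≤m+n d b)) e≤
      c+e≤ : c + e ≤ M
      c+e≤ = subst (_≤ M) (+-comm e c) cl₄≤
      X≤ : (c + e) ⊔ ((d + 0) ⊔ e) ≤ M
      X≤ = ⊔-lub c+e≤ Y≤
      b+Y≤ : b + ((d + 0) ⊔ e) ≤ M
      b+Y≤ = subst (_≤ M) (sym (+-distribˡ-⊔ b (d + 0) e))
               (⊔-lub (≤-reflexive (trans (cong (b +_) (+-identityʳ d)) (+-comm b d))) cl₂≤)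
      a+X≤ : a + ((c + e) ⊔ ((d + 0) ⊔ e)) ≤ M
      a+X≤ = subst (_≤ M) (sym (trans (+-distribˡ-⊔ a (c + e) _) (cong ((a + (c + e)) ⊔_) (+-distribˡ-⊔ a (d + 0) e))))
               (⊔-lub (≤-trans (≤-reflexive (x+[y+z]≡y+[x+z] a c e)) rest≤)
                      (⊔-lub (subst (λ d′ → a + d′ ≤ M) (sym (+-identityʳ d)) cl₃≤)
                             (≤-trans (m≤n+m (a + e) c) rest≤)))
        where
        x+[y+z]≡y+[x+z] : ∀ x y z → x + (y + z) ≡ y + (x + z)
        x+[y+z]≡y+[x+z] = solve-∀

  -- When the rest is no heavier than a heaviest clique C₀ ∪ C₂, colour along
  -- the path 3, 2, 1, 0, 4: its independent sets weigh at most that clique.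
  certificate₅-clique : (w : Fin 5 → ℕ) → (∀ a → cl w a ≤ cl w c₀) → rest w c₀ ≤ cl w c₀ → Certificate w
  certificate₅-clique w heaviest rest≤ =
    colouring+clique⇒certificate 3≤5
      (Colouring-mono (path₅-stable {w c₃} {w c₂} {w c₁} {w c₀} {w c₄} rest≤ (heaviest c₃) (heaviest c₂) (heaviest c₄))
        (colouring-along w (c₃ ∷ c₂ ∷ c₁ ∷ c₀ ∷ c₄ ∷ [])
          (inj₂ (inj₁ refl) ∷ inj₂ (inj₁ refl) ∷ inj₂ (inj₁ refl) ∷ inj₂ (inj₂ (inj₁ (refl , refl))) ∷ [-])
          (inj₁ ∘ every-class)))
      (clique-pair w (λ ()) (¬cycleAdj c₀ c₂))
    where
    every-class : ∀ x → x ∈ c₃ ∷ c₂ ∷ c₁ ∷ c₀ ∷ c₄ ∷ []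
    every-class zero                         = there (there (there (here refl)))
    every-class (suc zero)                   = there (there (here refl))
    every-class (suc (suc zero))             = there (here refl)
    every-class (suc (suc (suc zero)))       = here refl
    every-class (suc (suc (suc (suc zero)))) = there (there (there (there (here refl))))

  total₅ : (Fin 5 → ℕ) → ℕ
  total₅ w = w c₀ + (w c₁ + (w c₂ + (w c₃ + w c₄)))

  cl+rest : ∀ w a → cl w a + rest w a ≡ total₅ w
  cl+rest w zero                         = around₀ (w c₀) (w c₁) (w c₂) (w c₃) (w c₄)
    where around₀ : ∀ a b c d e → (a + c) + (b + (d + e)) ≡ a + (b + (c + (d + e))) ; around₀ = solve-∀
  cl+rest w (suc zero)                   = around₁ (w c₀) (w c₁) (w c₂) (w c₃) (w c₄)
    where around₁ : ∀ a b c d e → (b + d) + (c + (e + a)) ≡ a + (b + (c + (d + e))) ; around₁ = solve-∀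
  cl+rest w (suc (suc zero))             = around₂ (w c₀) (w c₁) (w c₂) (w c₃) (w c₄)
    where around₂ : ∀ a b c d e → (c + e) + (d + (a + b)) ≡ a + (b + (c + (d + e))) ; around₂ = solve-∀
  cl+rest w (suc (suc (suc zero)))       = around₃ (w c₀) (w c₁) (w c₂) (w c₃) (w c₄)
    where around₃ : ∀ a b c d e → (d + a) + (e + (b + c)) ≡ a + (b + (c + (d + e))) ; around₃ = solve-∀
  cl+rest w (suc (suc (suc (suc zero)))) = around₄ (w c₀) (w c₁) (w c₂) (w c₃) (w c₄)
    where around₄ : ∀ a b c d e → (e + b) + (a + (c + d)) ≡ a + (b + (c + (d + e))) ; around₄ = solve-∀

  -- With an even number 2h of vertices and all cliques of size at most h,
  -- the pair {a + 3, a + 4} is used h - |C_a ∪ C_(a+2)| times; every class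
  -- then lies in exactly as many colour classes as it has vertices.
  even-colouring : ∀ u h → total₅ u ≡ h + h → (∀ a → cl u a ≤ h) → Colouring u h
  even-colouring u h total≡ small =
    blocks bs , blocks⁺ {bs = bs} (inj₁ refl ∷ inj₁ refl ∷ inj₁ refl ∷ inj₁ refl ∷ inj₂ (inj₂ (inj₂ (refl , refl))) ∷ []) ,
    covers , ≤-reflexive (trans (length-blocks bs) size≡)
    where
    m : Fin 5 → ℕ
    m a = h ∸ cl u a
    m+cl≡h : ∀ a → m a + cl u a ≡ h
    m+cl≡h a = m∸n+n≡m (small a)
    bs = (m c₂ , pair c₀ c₁) ∷ (m c₃ , pair c₁ c₂) ∷ (m c₄ , pair c₂ c₃) ∷ (m c₀ , pair c₃ c₄) ∷ (m c₁ , pair c₄ c₀) ∷ []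
    per-class : ∀ x → blocks-load bs x ≡ weightOf ((c₀ , m c₂ + m c₁) ∷ (c₁ , m c₃ + m c₂) ∷ (c₂ , m c₄ + m c₃) ∷
                                                  (c₃ , m c₀ + m c₄) ∷ (c₄ , m c₁ + m c₀) ∷ []) x
    per-class x = regroup (m c₀) (m c₁) (m c₂) (m c₃) (m c₄)
                    (indicator c₀ x) (indicator c₁ x) (indicator c₂ x) (indicator c₃ x) (indicator c₄ x)
      where
      regroup : ∀ m₀ m₁ m₂ m₃ m₄ i₀ i₁ i₂ i₃ i₄ →
                m₂ * (i₀ + i₁) + (m₃ * (i₁ + i₂) + (m₄ * (i₂ + i₃) + (m₀ * (i₃ + i₄) + (m₁ * (i₄ + i₀) + 0)))) ≡
                (m₂ + m₁) * i₀ + ((m₃ + m₂) * i₁ + ((m₄ + m₃) * i₂ + ((m₀ + m₄) * i₃ + ((m₁ + m₀) * i₄ + 0))))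
      regroup = solve-∀
    exact : ∀ a → u a ≡ m (rotate 2 a) + m (rotate 1 a)
    exact a = +-cancelʳ-≡ _ _ _ (begin
      u a + (cl u (rotate 1 a) + cl u (rotate 2 a))  ≡⟨ around (u a) (u (rotate 1 a)) (u (rotate 2 a)) (u (rotate 3 a)) (u (rotate 4 a)) ⟩
      cl u a + rest u a                              ≡⟨ trans (cl+rest u a) total≡ ⟩
      h + h                                          ≡⟨ cong₂ _+_ (m+cl≡h (rotate 2 a)) (m+cl≡h (rotate 1 a)) ⟨
      (m (rotate 2 a) + cl u (rotate 2 a)) + (m (rotate 1 a) + cl u (rotate 1 a))
        ≡⟨ shuffle (m (rotate 2 a)) (cl u (rotate 2 a)) (m (rotate 1 a)) (cl u (rotate 1 a)) ⟩
      (m (rotate 2 a) + m (rotate 1 a)) + (cl u (rotate 1 a) + cl u (rotate 2 a)) ∎)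
      where
      open ≡-Reasoning
      around : ∀ a b c d e → a + ((b + d) + (c + e)) ≡ (a + c) + (b + (d + e))
      around = solve-∀
      shuffle : ∀ a b c d → (a + b) + (c + d) ≡ (a + c) + (d + b)
      shuffle = solve-∀
    covers : ∀ x → u x ≤ loads (blocks bs) x
    covers x = ≤-trans (weightOf-≥ {u = u} _ (≤-reflexive (exact c₀) ∷ ≤-reflexive (exact c₁) ∷ ≤-reflexive (exact c₂) ∷
                                       ≤-reflexive (exact c₃) ∷ ≤-reflexive (exact c₄) ∷ []) (every-class₅ x))
                       (≤-reflexive (sym (trans (loads-blocks bs x) (per-class x))))
    size≡ : blocks-size bs ≡ h
    size≡ = +-cancelʳ-≡ _ _ _ (begin
      blocks-size bs + (cl u c₂ + (cl u c₃ + (cl u c₄ + (cl u c₀ + cl u c₁))))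
        ≡⟨ pair-up (m c₂) (m c₃) (m c₄) (m c₀) (m c₁) (cl u c₂) (cl u c₃) (cl u c₄) (cl u c₀) (cl u c₁) ⟩
      (m c₂ + cl u c₂) + ((m c₃ + cl u c₃) + ((m c₄ + cl u c₄) + ((m c₀ + cl u c₀) + (m c₁ + cl u c₁))))
        ≡⟨ cong₂ _+_ (m+cl≡h c₂) (cong₂ _+_ (m+cl≡h c₃) (cong₂ _+_ (m+cl≡h c₄) (cong₂ _+_ (m+cl≡h c₀) (m+cl≡h c₁)))) ⟩
      h + (h + (h + (h + h)))
        ≡⟨ cong (h +_) (trans (cl-sum (u c₀) (u c₁) (u c₂) (u c₃) (u c₄))
                              (trans (cong₂ _+_ total≡ total≡) (+-assoc h h (h + h)))) ⟨
      h + (cl u c₂ + (cl u c₃ + (cl u c₄ + (cl u c₀ + cl u c₁)))) ∎)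
      where
      open ≡-Reasoning
      pair-up : ∀ m₂ m₃ m₄ m₀ m₁ k₂ k₃ k₄ k₀ k₁ →
                (m₂ + (m₃ + (m₄ + (m₀ + (m₁ + 0))))) + (k₂ + (k₃ + (k₄ + (k₀ + k₁)))) ≡
                (m₂ + k₂) + ((m₃ + k₃) + ((m₄ + k₄) + ((m₀ + k₀) + (m₁ + k₁))))
      pair-up = solve-∀
      cl-sum : ∀ a b c d e → (c + e) + ((d + a) + ((e + b) + ((a + c) + (b + d)))) ≡
                             (a + (b + (c + (d + e)))) + (a + (b + (c + (d + e))))
      cl-sum = solve-∀

  -- When every clique is lighter than its complement, a heaviest class C₀
  -- together with min(w₁,w₃) pairs {1,3} and min(w₂,w₄) pairs {2,4} gives
  -- branch sets covering at least half of the vertices.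
  balanced-model : (w : Fin 5 → ℕ) → (∀ x → w x ≤ w c₀) → (∀ a → cl w a < rest w a) →
                   ∃[ B ] All IsBranchSet B × (∀ x → loads B x ≤ w x) × AllPairs Touches B × total₅ w ≤ length B + length B
  balanced-model w heaviest light =
    blocks bs , blocks⁺ {bs = bs} (tt ∷ ¬cycleAdj c₁ c₃ ∷ ¬cycleAdj c₂ c₄ ∷ []) , fits ,
    blocks-touch {bs = bs} (touches-self 3≤5 _ ∷ touches-self 3≤5 _ ∷ touches-self 3≤5 _ ∷ [])
                 (((c₀ , c₃ , refl , inj₂ refl , ¬cycleAdj c₀ c₃) ∷ (c₀ , c₂ , refl , inj₁ refl , ¬cycleAdj c₀ c₂) ∷ []) ∷
                  ((c₁ , c₄ , inj₁ refl , inj₂ refl , ¬cycleAdj c₁ c₄) ∷ []) ∷ [] ∷ []) ,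
    subst (λ b → total₅ w ≤ b + b) (sym (length-blocks bs)) half
    where
    W = w c₀ ; p = w c₁ ; q = w c₂ ; r = w c₃ ; s = w c₄
    bs = (W , single c₀) ∷ (p ⊓ r , pair c₁ c₃) ∷ (q ⊓ s , pair c₂ c₄) ∷ []
    fits : ∀ x → loads (blocks bs) x ≤ w x
    fits x = subst (_≤ w x) (sym (trans (loads-blocks bs x) (regroup W (p ⊓ r) (q ⊓ s) _ _ _ _ _)))
               (weightOf-≤ {w = w} ((c₀ , W) ∷ (c₁ , p ⊓ r) ∷ (c₃ , p ⊓ r) ∷ (c₂ , q ⊓ s) ∷ (c₄ , q ⊓ s) ∷ [])
                  (((λ ()) ∷ (λ ()) ∷ (λ ()) ∷ (λ ()) ∷ []) ∷ ((λ ()) ∷ (λ ()) ∷ (λ ()) ∷ []) ∷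
                   ((λ ()) ∷ (λ ()) ∷ []) ∷ ((λ ()) ∷ []) ∷ [] ∷ [])
                  (≤-refl ∷ m⊓n≤m p r ∷ m⊓n≤n p r ∷ m⊓n≤m q s ∷ m⊓n≤n q s ∷ []) x)
      where
      regroup : ∀ W a b i₀ i₁ i₂ i₃ i₄ → W * i₀ + (a * (i₁ + i₃) + (b * (i₂ + i₄) + 0)) ≡
                                         W * i₀ + (a * i₁ + (a * i₃ + (b * i₂ + (b * i₄ + 0))))
      regroup = solve-∀
    half : total₅ w ≤ blocks-size bs + blocks-size bs
    half = begin
      W + (p + (q + (r + s)))                              ≡⟨ cong (W +_) (regroup p q r s) ⟩
      W + ((p + r) + (q + s))                              ≡⟨ cong (λ t → W + (t + (q + s))) (m⊓n+m⊔n≡m+n p r) ⟨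
      W + ((p ⊓ r + (p ⊔ r)) + (q + s))                      ≡⟨ cong (λ t → W + ((p ⊓ r + (p ⊔ r)) + t)) (m⊓n+m⊔n≡m+n q s) ⟨
      W + ((p ⊓ r + (p ⊔ r)) + (q ⊓ s + (q ⊔ s)))              ≡⟨ split W (p ⊓ r) (p ⊔ r) (q ⊓ s) (q ⊔ s) ⟩
      (W + (p ⊓ r + (q ⊓ s + 0))) + ((p ⊔ r) + (q ⊔ s))    ≤⟨ +-monoʳ-≤ (W + (p ⊓ r + (q ⊓ s + 0)))
                                                                 (≤-trans (balance (heaviest c₁) (heaviest c₃) (heaviest c₄) (light c₀) (light c₃) (light c₄)) (≤-reflexive (cong (λ t → W + (p ⊓ r + t)) (sym (+-identityʳ _))))) ⟩
      (W + (p ⊓ r + (q ⊓ s + 0))) + (W + (p ⊓ r + (q ⊓ s + 0))) ∎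
      where
      open ≤-Reasoning
      regroup : ∀ p q r s → p + (q + (r + s)) ≡ (p + r) + (q + s)
      regroup = solve-∀
      split : ∀ W a A b B → W + ((a + A) + (b + B)) ≡ (W + (a + (b + 0))) + (A + B)
      split = solve-∀

  pad₀ : (Fin 5 → ℕ) → ℕ → Fin 5 → ℕ
  pad₀ w e zero    = w zero + e
  pad₀ w e (suc x) = w (suc x)

  ≤-pad₀ : ∀ w e x → w x ≤ pad₀ w e x
  ≤-pad₀ w e zero    = m≤m+n _ e
  ≤-pad₀ w e (suc x) = ≤-refl

  cl-pad₀ : ∀ w e a → cl (pad₀ w e) a ≤ cl w a + e
  cl-pad₀ w e zero                         = ≤-reflexive (x+y+z≡x+z+y (w c₀) e (w c₂))
    where x+y+z≡x+z+y : ∀ x y z → x + y + z ≡ x + z + y ; x+y+z≡x+z+y = solve-∀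
  cl-pad₀ w e (suc zero)                   = m≤m+n _ e
  cl-pad₀ w e (suc (suc zero))             = m≤m+n _ e
  cl-pad₀ w e (suc (suc (suc zero)))       = ≤-reflexive (sym (+-assoc (w c₃) (w c₀) e))
  cl-pad₀ w e (suc (suc (suc (suc zero)))) = m≤m+n _ e

  total-pad₀ : ∀ w e → total₅ (pad₀ w e) ≡ total₅ w + e
  total-pad₀ w e = x+e+y≡x+y+e (w c₀) e _
    where x+e+y≡x+y+e : ∀ x e y → (x + e) + y ≡ (x + y) + e ; x+e+y≡x+y+e = solve-∀

  -- An odd number of vertices is made even by one more vertex in C₀.
  balanced-colouring : ∀ w → (∀ a → cl w a < rest w a) → ∃[ h ] Colouring w h × h + h ≤ suc (total₅ w)
  balanced-colouring w light =
    let h , e , e≤1 , n+e≡h+h = halve (total₅ w)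
        L , ok , covers , size = even-colouring (pad₀ w e) h (trans (total-pad₀ w e) n+e≡h+h) (small e≤1 n+e≡h+h)
    in h , (L , ok , (λ x → ≤-trans (≤-pad₀ w e x) (covers x)) , size) ,
       ≤-trans (≤-reflexive (sym n+e≡h+h)) (subst (total₅ w + e ≤_) (+-comm _ 1) (+-monoʳ-≤ (total₅ w) e≤1))
    where
    small : ∀ {h e} → e ≤ 1 → total₅ w + e ≡ h + h → ∀ a → cl (pad₀ w e) a ≤ h
    small {h} {e} e≤1 n+e≡h+h a = ≤-trans (cl-pad₀ w e a) (half-≤ (begin
      (cl w a + e) + (cl w a + e)     ≡⟨ interchange (cl w a) e ⟩
      (cl w a + cl w a) + (e + e)     ≤⟨ +-monoʳ-≤ (cl w a + cl w a) (+-monoʳ-≤ e e≤1) ⟩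
      (cl w a + cl w a) + (e + 1)     ≡⟨ carry (cl w a + cl w a) e ⟩
      suc (cl w a + cl w a) + e       ≤⟨ +-monoˡ-≤ e (subst (cl w a + cl w a <_) (cl+rest w a) (+-monoʳ-< (cl w a) (light a))) ⟩
      total₅ w + e                    ≡⟨ n+e≡h+h ⟩
      h + h                           ≤⟨ n≤1+n _ ⟩
      suc (h + h)                     ∎))
      where
      open ≤-Reasoning
      interchange : ∀ c e → (c + e) + (c + e) ≡ (c + c) + (e + e)
      interchange = solve-∀
      carry : ∀ c e → c + (e + 1) ≡ suc c + e
      carry = solve-∀

  certificate₅-balanced : (w : Fin 5 → ℕ) → (∀ x → w x ≤ w c₀) → (∀ a → cl w a < rest w a) → Certificate w
  certificate₅-balanced w heaviest light =
    let h , (L , ok , covers , size) , h+h≤n+1 = balanced-colouring w light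
        B , B-ok , fits , touching , n≤B+B      = balanced-model w heaviest light
    in record
      { colours       = L
      ; branches      = B
      ; colours-ok    = ok
      ; branches-ok   = B-ok
      ; covers        = covers
      ; fits          = fits
      ; touching      = touching
      ; fewer-colours = ≤-trans size (half-≤ (≤-trans h+h≤n+1 (s≤s n≤B+B)))
      }

  certificate₅ : (w : Fin 5 → ℕ) → Certificate w
  certificate₅ w = let a , heaviest = maximiser (cl w) in by-clique a heaviest (rest w a ≤? cl w a)
    where
    by-clique : ∀ a → (∀ b → cl w b ≤ cl w a) → Dec (rest w a ≤ cl w a) → Certificate w
    by-clique a heaviest (yes rest≤cl) =
      Transport.transport (rotation (toℕ a)) (certificate₅-clique (w ∘ rotate (toℕ a))
        (λ b → subst₂ _≤_ (sym (cl-rotate w (toℕ a) b)) (sym cl-at-a) (heaviest _))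
        (subst₂ _≤_ (sym rest-at-a) (sym cl-at-a) rest≤cl))
      where
      cl-at-a : cl (w ∘ rotate (toℕ a)) c₀ ≡ cl w a
      cl-at-a = trans (cl-rotate w (toℕ a) c₀) (cong (cl w) (rotation-zero a))
      rest-at-a : rest (w ∘ rotate (toℕ a)) c₀ ≡ rest w a
      rest-at-a = trans (rest-rotate w (toℕ a) c₀) (cong (rest w) (rotation-zero a))
    by-clique a heaviest (no rest≰cl) =
      let z , heaviest-class = maximiser w in
      Transport.transport (rotation (toℕ z)) (certificate₅-balanced (w ∘ rotate (toℕ z))
        (λ x → subst (w (rotate (toℕ z) x) ≤_) (sym (cong w (rotation-zero z))) (heaviest-class _))
        (λ b → subst₂ _<_ (sym (cl-rotate w (toℕ z) b)) (sym (rest-rotate w (toℕ z) b)) (light _)))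
      where
      light : ∀ b → cl w b < rest w b
      light b = ≤-<-trans (heaviest b) (<-≤-trans (≰⇒> rest≰cl)
                  (+-cancelˡ-≤ (cl w b) (rest w a) (rest w b)
                     (≤-trans (+-monoˡ-≤ (rest w a) (heaviest b))
                              (≤-reflexive (trans (cl+rest w a) (sym (cl+rest w b)))))))

certificate : ∀ k → 3 ≤ k → (c : Fin k → ℕ) → IndependenceNumber (InflatedComplementCycle k c) 2 → Certificate c
certificate 1 (s≤s ())
certificate 2 (s≤s (s≤s ()))
certificate 3 3≤3 c α≡2 = let z , cz≡0 = some-class-empty₃ c α≡2 in certificate-with-zero 3≤3 c z cz≡0
certificate 4 _ c _ = certificate₄ c
certificate 5 _ c _ = certificate₅ c
certificate (suc (suc (suc (suc (suc (suc m)))))) _ c _ = certificate₆₊ c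

corollary3p4 : (k : ℕ) → 3 ≤ k → (c : Fin k → ℕ) →
    let G = InflatedComplementCycle k c in
    IndependenceNumber G 2 → (t : ℕ) → ChromaticNumber G t →
    Σ[ M ∈ KModel G t ] (∀ i → length (branch M i) ≤ 2)
corollary3p4 k 3≤k c α≡2 = Realisation.certificate⇒model 3≤k c (certificate k 3≤k c α≡2)
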